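{- Let $\lambda/\mu$ be a skew partition and let $\mathbf{D}=\{\theta_1,\ldots,\theta_k\}$ be any outside decomposition of $\lambda/\mu$. Let $G^{\mathbf{D}}_{\lambda/\mu}=\left(s_{[\tau(p(\theta_i)),\tau(q(\theta_j))]}\right)_{i,j=1}^k$ and let $\mathrm{grank}_{\mathbf{D}}(\lambda/\mu)$ be the number of rows of $G^{\mathbf{D}}_{\lambda/\mu}$ that contain no entry equal to $1$. Then $\mathrm{grank}_{\mathbf{D}}(\lambda/\mu)=\mathrm{rank}(\lambda/\mu)$.
   Context: Squares $(i,j)$ of Young diagrams (English convention) have content $\tau(i,j)=j-i$. The rank of a skew partition: a square $(i,j)$ is an inner corner of $\lambda/\mu$ if $(i,j),(i,j-1),(i-1,j)\in\lambda/\mu$ but $(i-1,j-1)\notin\lambda/\mu$, and an outer corner if $(i,j)\in\lambda/\mu$ but $(i-1,j-1),(i,j-1),(i-1,j)\notin\lambda/\mu$; the diagonal of such a corner consists of the squares $(i+p,j+p)\in\lambda/\mu$, $p\ge0$; $\mathrm{rank}(\lambda/\mu)=d^+-d^-$ where $d^+$ (resp. $d^-$) is the total number of squares on diagonals of outer (resp. inner) corners. A border strip is a connected skew diagram containing no $2\times 2$ square. A decomposition of $\lambda/\mu$ into disjoint border strips is an outside decomposition if every strip starts at a square on the left or bottom perimeter of the diagram and ends at a square on the right or top perimeter. For a strip $\theta$, $p(\theta)$ is its lower-left (starting) square and $q(\theta)$ its upper-right (ending) square. Suppose the squares of $\lambda/\mu$ have $k'$ distinct contents $c_1<c_2<\cdots<c_{k'}$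 (the diagonals). In an outside decomposition, each square not at the end of its strip has direction "up" or "right" according as the next square of its strip lies above it or to its right; all squares on the same diagonal have the same direction. The cutting strip $\phi$ is the border strip of $k'$ squares, the $i$-th of which is assigned content $c_i$, such that for $i=1,\ldots,k'-1$ the $(i+1)$-th square lies above (resp. to the right of) the $i$-th exactly when the $i$-th diagonal has direction up (resp. right). For integers $\alpha,\beta$: if $\alpha\le\beta$, $[\alpha,\beta]$ is the segment of $\phi$ from the square of content $\alpha$ to the square of content $\beta$ and $s_{[\alpha,\beta]}$ is the skew Schur function of this border strip shape; if $\alpha=\beta+1$, $s_{[\alpha,\beta]}=1$; if $\alpha>\beta+1$, $s_{[\alpha,\beta]}=0$. (Hamel–Goulden: $s_{\lambda/\mu}=\det G^{\mathbf{D}}_{\lambda/\mu}$.) -}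

module Defs where

open import Data.Bool using (Bool; true; false; _∧_; _∨_; not; if_then_else_; T)
open import Data.Nat as ℕ using (ℕ; zero; suc; _≤_; _≡ᵇ_; _≤ᵇ_; _<ᵇ_)
open import Data.Integer as ℤ using (ℤ; +_)
import Data.Integer.Properties as ℤP
open import Data.Product using (_×_; _,_; proj₁; proj₂; Σ)
open import Data.Sum using (_⊎_)
open import Data.List as List using (List; []; _∷_; map; filter; length; concatMap; upTo; concat; foldr; zip)
open import Data.Bool.ListAction using (any; all)
open import Data.Nat.ListAction using (sum)
open import Data.List.NonEmpty as List⁺ using (List⁺; head; last; toList)
open import Data.List.Relation.Unary.Linked using (Linked)
open import Data.List.Relation.Unary.All using (All)
open import Data.List.Relation.Unary.Unique.Propositional using (Unique)
open import Data.List.Membership.Propositional using (_∈_)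
open import Data.Fin using (Fin)
open import Data.Fin.Subset using (Subset; ∣_∣) renaming (_∈_ to _∈ₛ_)
open import Function.Bundles using (_⇔_)
open import Relation.Nullary using (¬_; does)
open import Relation.Binary.PropositionalEquality using (_≡_)

filterB : {A : Set} → (A → Bool) → List A → List A
filterB f []       = []
filterB f (x ∷ xs) = if f x then x ∷ filterB f xs else filterB f xs

-- Partitions and skew shapes (1-indexed rows i and columns j, English
-- convention; a partition is a weakly decreasing list of parts, zero
-- parts allowed).

part : List ℕ → ℕ → ℕ
part []       _             = 0
part (x ∷ xs) zero          = 0
part (x ∷ xs) (suc zero)    = x
part (x ∷ xs) (suc (suc i)) = part xs (suc i)

IsPartition : List ℕ → Set
IsPartition = Linked (λ a b → b ≤ a)

_⊆ₚ_ : List ℕ → List ℕ → Set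
μ ⊆ₚ λ' = ∀ i → part μ i ≤ part λ' i

Square : Set
Square = ℕ × ℕ                 -- (row i, column j)

inSkew : List ℕ → List ℕ → ℕ → ℕ → Bool
inSkew λ' μ i j = (1 ≤ᵇ i) ∧ (1 ≤ᵇ j) ∧ (j ≤ᵇ part λ' i) ∧ not (j ≤ᵇ part μ i)

InSkew : List ℕ → List ℕ → Square → Set
InSkew λ' μ (i , j) = T (inSkew λ' μ i j)

τ : Square → ℤ
τ (i , j) = (+ j) ℤ.- (+ i)

cellsSkew : List ℕ → List ℕ → List Square
cellsSkew λ' μ =
  concatMap (λ i → concatMap (λ j → if inSkew λ' μ i j then (i , j) ∷ [] else [])
                               (map suc (upTo (part λ' i))))
            (map suc (upTo (length λ')))

-- number of squares (i+p, j+p) ∈ λ/μ, p ≥ 0 (rows beyond length λ are empty)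
diagLen : List ℕ → List ℕ → Square → ℕ
diagLen λ' μ (i , j) =
  length (filterB (λ p → (inSkew λ' μ (i ℕ.+ p) (j ℕ.+ p)))
                 (upTo (suc (length λ'))))

isInnerCorner : List ℕ → List ℕ → Square → Bool
isInnerCorner λ' μ (i , j) =
  inSkew λ' μ i j ∧ inSkew λ' μ i (j ℕ.∸ 1) ∧ inSkew λ' μ (i ℕ.∸ 1) j
    ∧ not (inSkew λ' μ (i ℕ.∸ 1) (j ℕ.∸ 1))

isOuterCorner : List ℕ → List ℕ → Square → Bool
isOuterCorner λ' μ (i , j) =
  inSkew λ' μ i j ∧ not (inSkew λ' μ (i ℕ.∸ 1) (j ℕ.∸ 1))
    ∧ not (inSkew λ' μ i (j ℕ.∸ 1)) ∧ not (inSkew λ' μ (i ℕ.∸ 1) j)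

dPlus dMinus : List ℕ → List ℕ → ℕ
dPlus λ' μ =
  sum (map (diagLen λ' μ) (filterB (λ c → (isOuterCorner λ' μ c)) (cellsSkew λ' μ)))
dMinus λ' μ =
  sum (map (diagLen λ' μ) (filterB (λ c → (isInnerCorner λ' μ c)) (cellsSkew λ' μ)))

rank : List ℕ → List ℕ → ℤ
rank λ' μ = (+ dPlus λ' μ) ℤ.- (+ dMinus λ' μ)

-- Border strips, listed from the starting (lower-left) square p(θ) to the
-- ending (upper-right) square q(θ); each next square lies directly above
-- or directly to the right of the previous one.  (Such paths are exactly
-- the border strips: connected skew diagrams with no 2×2 square.)

Strip : Set
Strip = List⁺ Square

Step : Square → Square → Set
Step (i , j) (i' , j') = (suc i' ≡ i × j' ≡ j) ⊎ (i' ≡ i × j' ≡ suc j)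

IsBorderStrip : Strip → Set
IsBorderStrip θ = Linked Step (toList θ)

p q : Strip → Square
p = head
q = last

OnLeftOrBottom : List ℕ → List ℕ → Square → Set
OnLeftOrBottom λ' μ (i , j) = T (not (inSkew λ' μ i (j ℕ.∸ 1)) ∨ not (inSkew λ' μ (suc i) j))

OnRightOrTop : List ℕ → List ℕ → Square → Set
OnRightOrTop λ' μ (i , j) = T (not (inSkew λ' μ i (suc j)) ∨ not (inSkew λ' μ (i ℕ.∸ 1) j))

record OutsideDecomposition (λ' μ : List ℕ) (D : List Strip) : Set where
  field
    strips    : All IsBorderStrip D
    disjoint  : Unique (concat (map toList D))
    covers    : ∀ s → (s ∈ concat (map toList D)) ⇔ InSkew λ' μ s
    starts    : All (λ θ → OnLeftOrBottom λ' μ (p θ)) D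
    ends      : All (λ θ → OnRightOrTop λ' μ (q θ)) D

-- Symmetric functions, represented by their coefficient functions:
-- f w = coefficient of x₁^{w₁} x₂^{w₂} ⋯ x_m^{w_m}.

Weight : Set
Weight = List ℕ

SymFn : Set
SymFn = Weight → ℕ

oneF : SymFn
oneF w = if all (λ n → n ≡ᵇ 0) w then 1 else 0

zeroF : SymFn
zeroF _ = 0

fillings : ℕ → ℕ → List (List ℕ)
fillings m zero    = [] ∷ []
fillings m (suc n) = concatMap (λ v → map (v ∷_) (fillings m n)) (map suc (upTo m))

eqℤ : ℤ → ℤ → Bool
eqℤ a b = does (a ℤP.≟ b)

-- semistandard condition on a filling of a finite set of cells (ℤ × ℤ,
-- row, column): weakly increasing along rows, strictly down columns
ssyt : List (ℤ × ℤ) → List ℕ → Bool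
ssyt cs t = all (λ a → all (λ b → check a b) ct) ct
  where
  ct = zip cs t
  check : (ℤ × ℤ) × ℕ → (ℤ × ℤ) × ℕ → Bool
  check ((r , c) , x) ((r' , c') , y) =
    (not (eqℤ r' r ∧ eqℤ c' (c ℤ.+ ℤ.1ℤ)) ∨ (x ≤ᵇ y))
    ∧ (not (eqℤ r' (r ℤ.+ ℤ.1ℤ) ∧ eqℤ c' c) ∨ (x <ᵇ y))

hasContent : Weight → List ℕ → Bool
hasContent w t = go 1 w
  where
  go : ℕ → Weight → Bool
  go r []       = true
  go r (n ∷ ns) = (length (filterB (λ x → x ≡ᵇ r) t) ≡ᵇ n) ∧ go (suc r) ns

skewSchur : List (ℤ × ℤ) → SymFn
skewSchur cs w =
  length (filterB (λ t → (ssyt cs t ∧ hasContent w t))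
                 (fillings (length w) (length cs)))

data Dir : Set where
  up right : Dir

dirsOf : List Square → List (ℤ × Dir)
dirsOf []                      = []
dirsOf (s ∷ [])                = []
dirsOf ((i , j) ∷ (i' , j') ∷ ss) =
  (τ (i , j) , (if i' ≡ᵇ i then right else up)) ∷ dirsOf ((i' , j') ∷ ss)

-- direction of the diagonal of content c (all squares on a diagonal have
-- the same direction; 'right' is an arbitrary default if no square of the
-- diagonal has a successor in its strip, which never matters below)
dirOf : List Strip → ℤ → Dir
dirOf D c = foldr (λ e r → if eqℤ (proj₁ e) c then proj₂ e else r) right
                  (concatMap (λ θ → dirsOf (toList θ)) D)

contents : List ℕ → List ℕ → List ℤ
contents λ' μ =
  filterB (λ c → (any (λ s → eqℤ (τ s) c) (cellsSkew λ' μ)))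
         (map (λ t → (+ t) ℤ.- (+ length λ')) (upTo (suc (length λ' ℕ.+ part λ' 1))))

-- φ: its squares, each paired with its assigned content
buildφ : List Strip → ℤ × ℤ → List ℤ → List (ℤ × (ℤ × ℤ))
buildφ D pos []       = []
buildφ D (r , c) (x ∷ xs) = (x , (r , c)) ∷ buildφ D next xs
  where
  next : ℤ × ℤ
  next with dirOf D x
  ... | up    = (r ℤ.- ℤ.1ℤ , c)
  ... | right = (r , c ℤ.+ ℤ.1ℤ)

cuttingStrip : List ℕ → List ℕ → List Strip → List (ℤ × (ℤ × ℤ))
cuttingStrip λ' μ D = buildφ D (ℤ.0ℤ , ℤ.0ℤ) (contents λ' μ)

segment : List (ℤ × (ℤ × ℤ)) → ℤ → ℤ → List (ℤ × ℤ)
segment φ α β =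
  map proj₂ (filterB (λ e → ((α ℤ.≤ᵇ proj₁ e) ∧ (proj₁ e ℤ.≤ᵇ β))) φ)

sSeg : List (ℤ × (ℤ × ℤ)) → ℤ → ℤ → SymFn
sSeg φ α β =
  if α ℤ.≤ᵇ β then skewSchur (segment φ α β)
  else if eqℤ α (β ℤ.+ ℤ.1ℤ) then oneF
  else zeroF

θ : (D : List Strip) → Fin (length D) → Strip
θ D = List.lookup D

G : List ℕ → List ℕ → (D : List Strip) → Fin (length D) → Fin (length D) → SymFn
G λ' μ D i j = sSeg (cuttingStrip λ' μ D) (τ (p (θ D i))) (τ (q (θ D j)))

_≗F_ : SymFn → SymFn → Set
f ≗F g = ∀ w → f w ≡ g w

RowHasNoOne : List ℕ → List ℕ → (D : List Strip) → Fin (length D) → Set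
RowHasNoOne λ' μ D i = ∀ j → ¬ (G λ' μ D i j ≗F oneF)

IsGRank : List ℕ → List ℕ → (D : List Strip) → ℕ → Set
IsGRank λ' μ D n =
  Σ (Subset (length D)) λ S → (∀ i → (i ∈ₛ S) ⇔ RowHasNoOne λ' μ D i) × (∣ S ∣ ≡ n)

-- Both numbers equal Σ_c (n_c ∸ n_{c-1}), where n_c is the number of squares of
-- λ/μ of content c, i.e. the length of diagonal c.
--
-- Rank: only the top square of a diagonal can be a corner; it is an outer corner
-- iff it has neither a left nor an upper neighbour, and an inner corner iff it has
-- both. Hence d⁺ − d⁻ = Σ_c n_c − Σ_c ([top of c has a left neighbour] n_c +
-- [top of c − 1 has an upper neighbour] n_{c-1}). By convexity of λ/μ exactly one
-- of these neighbours exists when both diagonals are nonempty, and it lies on the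
-- longer of the two diagonals, so the subtracted term is min (n_{c-1}, n_c).
--
-- grank: s_[α,β] = 1 exactly when α = β + 1, so row i of G has no entry 1 iff no
-- strip ends on the diagonal just before the one where θ_i starts. Successive
-- squares of a strip have consecutive contents, so counting the squares of
-- contents c and c − 1 strip by strip gives
--   #(strips starting on c) + n_{c-1} = n_c + #(strips ending on c − 1).
-- Without an end on c − 1 the starts on c number n_c − n_{c-1}; with one, the
-- outside condition leaves room for at most one start on c, forcing n_c ≤ n_{c-1}.

module Submission where

open import Algebra.Properties.CommutativeSemigroup using (interchange)
open import Data.Bool using (Bool; true; false; _∧_; _∨_; not; if_then_else_; T)
open import Data.Bool.ListAction using (any)
open import Data.Bool.Properties using (T-∧; T-∨; T-≡)
open import Data.Empty using (⊥; ⊥-elim)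
open import Data.Fin using (Fin)
open import Data.Fin.Subset using (Subset; ∣_∣) renaming (_∈_ to _∈ₛ_)
open import Data.Integer as ℤ using (ℤ; _-_; 0ℤ; 1ℤ)
import Data.Integer.Properties as ℤP
open import Data.Integer.Tactic.RingSolver using (solve-∀)
open import Data.List as List
  using (List; []; _∷_; map; filter; length; concat; concatMap; upTo; _++_; deduplicate; initLast; _∷ʳ′_)
open import Data.List.Membership.Propositional using (_∈_; find; lose)
open import Data.List.Membership.Propositional.Properties
open import Data.List.Membership.Propositional.Properties.WithK using (unique∧set⇒bag)
open import Data.List.NonEmpty as List⁺ using (List⁺; _∷_; toList; last)
open import Data.List.Properties using (length-map; length-filter; map-cong)
open import Data.List.Relation.Binary.BagAndSetEquality using (∼bag⇒↭)
open import Data.List.Relation.Binary.Permutation.Propositional using (_↭_; refl; prep; swap; trans)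
open import Data.List.Relation.Binary.Permutation.Propositional.Properties using (↭-length)
open import Data.List.Relation.Unary.All as All using ([]; _∷_)
import Data.List.Relation.Unary.All.Properties as All
open import Data.List.Relation.Unary.AllPairs as AllPairs using ([]; _∷_)
import Data.List.Relation.Unary.AllPairs.Properties as AllPairs
open import Data.List.Relation.Unary.Any as Any using (here; there; any?)
open import Data.List.Relation.Unary.Any.Properties using (any⁺; any⁻; lookup-index)
open import Data.List.Relation.Unary.Linked as Linked using (Linked; _∷_)
open import Data.List.Relation.Unary.Unique.DecPropositional.Properties using (deduplicate-!)
open import Data.List.Relation.Unary.Unique.Propositional using (Unique) renaming (tail to Unique-tail)
import Data.List.Relation.Unary.Unique.Propositional.Properties as Unique
open import Data.Nat as ℕ using (ℕ; zero; suc; _+_; _*_; _∸_; _⊓_; _≤_; _<_; z≤n; s≤s)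
open import Data.Nat.ListAction using (sum)
open import Data.Nat.Properties
open import Data.Nat.Tactic.RingSolver using () renaming (solve-∀ to ℕ-solve-∀)
open import Data.Product using (_×_; _,_; proj₁; proj₂; Σ; ∃-syntax)
open import Data.Product.Properties using (,-injectiveˡ; ,-injectiveʳ; ≡-dec)
open import Data.Sum as Sum using (_⊎_; inj₁; inj₂; [_,_]′)
open import Data.Vec using (tabulate)
open import Data.Vec.Properties using (lookup∘tabulate; []=⇒lookup; lookup⇒[]=)
open import Function.Base using (id; _∘_)
open import Function.Bundles using (_⇔_; mk⇔; Equivalence)
open import Relation.Binary.Definitions using (DecidableEquality; tri<; tri≈; tri>)
open import Relation.Binary.PropositionalEquality
  using (_≡_; _≢_; refl; sym; cong; cong₂; subst; subst₂; module ≡-Reasoning)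
  renaming (trans to ≡-trans)
open import Relation.Nullary using (¬_; Dec; does; yes; no)
open import Relation.Nullary.Decidable as Dec using (T?; does-⇔; ¬?)

open import Defs

-- Indicators and finite sums

𝟙 : Bool → ℕ
𝟙 true  = 1
𝟙 false = 0

𝟙-true : ∀ {b} → T b → 𝟙 b ≡ 1
𝟙-true {true} _ = refl

𝟙-false : ∀ {b} → ¬ T b → 𝟙 b ≡ 0
𝟙-false {true}  ¬b = ⊥-elim (¬b _)
𝟙-false {false} _  = refl

T-not⇔¬T : ∀ {b} → T (not b) ⇔ (¬ T b)
T-not⇔¬T {true}  = mk⇔ (λ ()) (λ ¬t → ¬t _)
T-not⇔¬T {false} = mk⇔ (λ _ ()) (λ _ → _)

T-not-∨ : ∀ {a b} → T (not a ∨ not b) → ¬ T a ⊎ ¬ T b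
T-not-∨ {a} t = Sum.map (Equivalence.to T-not⇔¬T) (Equivalence.to T-not⇔¬T) (Equivalence.to (T-∨ {not a}) t)

𝟙-mono : ∀ {a b} → (T a → T b) → 𝟙 a ≤ 𝟙 b
𝟙-mono {false} _   = z≤n
𝟙-mono {true}  a⇒b = ≤-reflexive (sym (𝟙-true (a⇒b _)))

T-does : ∀ {P : Set} (d : Dec P) → T (does d) ⇔ P
T-does (yes p) = mk⇔ (λ _ → p) (λ _ → _)
T-does (no ¬p) = mk⇔ (λ ()) ¬p

𝟙-∧-* : ∀ a b n → 𝟙 a * (𝟙 b * n) ≡ 𝟙 (a ∧ b) * n
𝟙-∧-* true  b n = +-identityʳ (𝟙 b * n)
𝟙-∧-* false b n = refl

∑ : {A : Set} → List A → (A → ℕ) → ℕ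
∑ []       f = 0
∑ (x ∷ xs) f = f x + ∑ xs f

infixr 5 ∑
syntax ∑ xs (λ x → e) = ∑[ x ∈ xs ] e

module _ {A : Set} where

  ∑-cong : ∀ (xs : List A) {f g : A → ℕ} → (∀ {x} → x ∈ xs → f x ≡ g x) → ∑ xs f ≡ ∑ xs g
  ∑-cong []       eq = refl
  ∑-cong (x ∷ xs) eq = cong₂ _+_ (eq (here refl)) (∑-cong xs (λ x∈ → eq (there x∈)))

  ∑-≡0 : ∀ {xs : List A} {f : A → ℕ} → (∀ {x} → x ∈ xs → f x ≡ 0) → ∑ xs f ≡ 0
  ∑-≡0 {[]}     eq = refl
  ∑-≡0 {x ∷ xs} eq = cong₂ _+_ (eq (here refl)) (∑-≡0 (λ x∈ → eq (there x∈)))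

  ∑-+ : ∀ (xs : List A) (f g : A → ℕ) → ∑[ x ∈ xs ] (f x + g x) ≡ ∑ xs f + ∑ xs g
  ∑-+ []       f g = refl
  ∑-+ (x ∷ xs) f g rewrite ∑-+ xs f g = interchange +-commutativeSemigroup (f x) (g x) (∑ xs f) (∑ xs g)

  ∑-*ʳ : ∀ (xs : List A) (f : A → ℕ) k → ∑[ x ∈ xs ] (f x * k) ≡ ∑ xs f * k
  ∑-*ʳ []       f k = refl
  ∑-*ʳ (x ∷ xs) f k = ≡-trans (cong (f x * k +_) (∑-*ʳ xs f k)) (sym (*-distribʳ-+ k (f x) (∑ xs f)))

  ∑-++ : ∀ (xs ys : List A) (f : A → ℕ) → ∑ (xs ++ ys) f ≡ ∑ xs f + ∑ ys f
  ∑-++ []       ys f = refl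
  ∑-++ (x ∷ xs) ys f = ≡-trans (cong (f x +_) (∑-++ xs ys f)) (sym (+-assoc (f x) _ _))

  ∑-↭ : ∀ {xs ys : List A} (f : A → ℕ) → xs ↭ ys → ∑ xs f ≡ ∑ ys f
  ∑-↭ f refl         = refl
  ∑-↭ f (prep x p)   = cong (f x +_) (∑-↭ f p)
  ∑-↭ f (swap x y p) = ≡-trans (sym (+-assoc (f x) (f y) _))
    (≡-trans (cong₂ _+_ (+-comm (f x) (f y)) (∑-↭ f p)) (+-assoc (f y) (f x) _))
  ∑-↭ f (trans p q)  = ≡-trans (∑-↭ f p) (∑-↭ f q)

  ≤-∑ : ∀ {xs : List A} (f : A → ℕ) {x} → x ∈ xs → f x ≤ ∑ xs f
  ≤-∑ {y ∷ ys} f (here refl) = m≤m+n (f y) (∑ ys f)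
  ≤-∑ {y ∷ ys} f (there x∈)  = ≤-trans (≤-∑ f x∈) (m≤n+m (∑ ys f) (f y))

  ∑-mono-≤ : ∀ {xs : List A} {f g : A → ℕ} → (∀ {x} → x ∈ xs → f x ≤ g x) → ∑ xs f ≤ ∑ xs g
  ∑-mono-≤ {[]}     le = z≤n
  ∑-mono-≤ {x ∷ xs} le = +-mono-≤ (le (here refl)) (∑-mono-≤ (λ x∈ → le (there x∈)))

module _ {A B : Set} where

  ∑-concatMap : ∀ (g : A → List B) (xs : List A) (f : B → ℕ) →
                ∑ (concatMap g xs) f ≡ ∑[ a ∈ xs ] ∑ (g a) f
  ∑-concatMap g []       f = refl
  ∑-concatMap g (x ∷ xs) f = ≡-trans (∑-++ (g x) _ f) (cong (∑ (g x) f +_) (∑-concatMap g xs f))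

  ∑-comm : ∀ (xs : List A) (ys : List B) (f : A → B → ℕ) →
           ∑[ x ∈ xs ] ∑[ y ∈ ys ] f x y ≡ ∑[ y ∈ ys ] ∑[ x ∈ xs ] f x y
  ∑-comm []       ys f = sym (∑-≡0 {xs = ys} (λ _ → refl))
  ∑-comm (x ∷ xs) ys f =
    ≡-trans (cong (∑ ys (f x) +_) (∑-comm xs ys f)) (sym (∑-+ ys (f x) (λ y → ∑[ x ∈ xs ] f x y)))

module _ {A : Set} (P : A → Bool) where

  filterB≡filter : ∀ xs → filterB P xs ≡ filter (λ x → T? (P x)) xs
  filterB≡filter []       = refl
  filterB≡filter (x ∷ xs) with P x
  ... | true  = cong (x ∷_) (filterB≡filter xs)
  ... | false = filterB≡filter xs

  ∈-filterB⁺ : ∀ {xs x} → x ∈ xs → T (P x) → x ∈ filterB P xs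
  ∈-filterB⁺ {xs} x∈ Px rewrite filterB≡filter xs = ∈-filter⁺ (λ x → T? (P x)) x∈ Px

  ∈-filterB⁻ : ∀ xs {x} → x ∈ filterB P xs → x ∈ xs × T (P x)
  ∈-filterB⁻ xs x∈ rewrite filterB≡filter xs = ∈-filter⁻ (λ x → T? (P x))  x∈

  Unique-filterB : ∀ {xs} → Unique xs → Unique (filterB P xs)
  Unique-filterB {xs} u rewrite filterB≡filter xs = Unique.filter⁺ (λ x → T? (P x)) u

  length-filterB : ∀ xs → length (filterB P xs) ≡ ∑[ x ∈ xs ] 𝟙 (P x)
  length-filterB []       = refl
  length-filterB (x ∷ xs) with P x
  ... | true  = cong suc (length-filterB xs)
  ... | false = length-filterB xs

  concatMap-if≡map-filterB : ∀ {B : Set} (g : A → B) xs →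
                             concatMap (λ x → if P x then g x ∷ [] else []) xs ≡ map g (filterB P xs)
  concatMap-if≡map-filterB g []       = refl
  concatMap-if≡map-filterB g (x ∷ xs) with P x
  ... | true  = cong (g x ∷_) (concatMap-if≡map-filterB g xs)
  ... | false = concatMap-if≡map-filterB g xs

  sum-map-filterB : ∀ (f : A → ℕ) xs → sum (map f (filterB P xs)) ≡ ∑[ x ∈ xs ] 𝟙 (P x) * f x
  sum-map-filterB f []       = refl
  sum-map-filterB f (x ∷ xs) with P x
  ... | true  = cong₂ _+_ (sym (+-identityʳ (f x))) (sum-map-filterB f xs)
  ... | false = sum-map-filterB f xs

  ∑𝟙*-unique : ∀ {xs x} (f : A → ℕ) → Unique xs → x ∈ xs → T (P x) →
               (∀ {y} → y ∈ xs → T (P y) → y ≡ x) → ∑[ y ∈ xs ] 𝟙 (P y) * f y ≡ f x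
  ∑𝟙*-unique {x ∷ xs} f u (here refl) Px only rewrite 𝟙-true Px =
    ≡-trans (cong₂ _+_ (+-identityʳ (f x)) (∑-≡0 others-vanish)) (+-identityʳ (f x))
    where
    others-vanish : ∀ {y} → y ∈ xs → 𝟙 (P y) * f y ≡ 0
    others-vanish {y} y∈ = cong (_* f y) (𝟙-false (λ Py →
      Unique.Unique[x∷xs]⇒x∉xs u (subst (_∈ xs) (only (there y∈) Py) y∈)))
  ∑𝟙*-unique {y ∷ xs} f u (there x∈) Px only =
    ≡-trans (cong (_+ ∑ xs (λ z → 𝟙 (P z) * f z)) head-vanishes)
            (∑𝟙*-unique f (Unique-tail u) x∈ Px (λ z∈ → only (there z∈)))
    where
    head-vanishes : 𝟙 (P y) * f y ≡ 0
    head-vanishes = cong (_* f y) (𝟙-false (λ Py →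
      Unique.Unique[x∷xs]⇒x∉xs u (subst (_∈ xs) (sym (only (here refl) Py)) x∈)))

module _ {A : Set} where

  Unique-↭ : ∀ {xs ys : List A} → Unique xs → Unique ys → (∀ {x} → x ∈ xs ⇔ x ∈ ys) → xs ↭ ys
  Unique-↭ u v same = ∼bag⇒↭ (unique∧set⇒bag u v same)

  length≤1 : ∀ {xs : List A} → Unique xs → (∀ {x y} → x ∈ xs → y ∈ xs → x ≡ y) → length xs ≤ 1
  length≤1 {[]}             _                  _   = z≤n
  length≤1 {x ∷ []}         _                  _   = ≤-refl
  length≤1 {x ∷ y ∷ _} ((x≢y ∷ _) ∷ _) all≡ = ⊥-elim (x≢y (all≡ (here refl) (there (here refl))))

  Unique-⊆⇒length≤ : DecidableEquality A → ∀ {xs ys : List A} → Unique xs → Unique ys →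
                     (∀ {x} → x ∈ xs → x ∈ ys) → length xs ≤ length ys
  Unique-⊆⇒length≤ _≟_ {xs} {ys} u v xs⊆ys = begin
    length xs                ≡⟨ ↭-length (Unique-↭ u (Unique.filter⁺ ∈xs? v) same) ⟩
    length (filter ∈xs? ys)  ≤⟨ length-filter ∈xs? ys ⟩
    length ys                ∎
    where
    open ≤-Reasoning
    open import Data.List.Membership.DecPropositional _≟_ using (_∈?_)
    ∈xs? = _∈? xs
    same : ∀ {x} → x ∈ xs ⇔ x ∈ filter ∈xs? ys
    same = mk⇔ (λ x∈ → ∈-filter⁺ ∈xs? (xs⊆ys x∈) x∈)
               (λ x∈ → proj₂ (∈-filter⁻ ∈xs? {xs = ys} x∈))

module _ {A B : Set} where

  Unique-map⁺ : ∀ {xs : List A} (f : A → B) → (∀ {x y} → x ∈ xs → y ∈ xs → f x ≡ f y → x ≡ y) →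
                Unique xs → Unique (map f xs)
  Unique-map⁺ {[]}     f inj []         = []
  Unique-map⁺ {x ∷ xs} f inj (x∉ ∷ u) =
    All.map⁺ (All.tabulate (λ y∈ fx≡fy → All.lookup x∉ y∈ (inj (here refl) (there y∈) fx≡fy)))
    ∷ Unique-map⁺ f (λ x∈ y∈ → inj (there x∈) (there y∈)) u

  length≤-injection : DecidableEquality B → ∀ {xs : List A} {ys : List B} (f : A → B) →
                      Unique xs → Unique ys → (∀ {x y} → x ∈ xs → y ∈ xs → f x ≡ f y → x ≡ y) →
                      (∀ {x} → x ∈ xs → f x ∈ ys) → length xs ≤ length ys
  length≤-injection _≟_ {xs} f u v inj into = begin
    length xs          ≡⟨ length-map f xs ⟨
    length (map f xs)  ≤⟨ Unique-⊆⇒length≤ _≟_ (Unique-map⁺ f inj u) v f[xs]⊆ys ⟩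
    _                  ∎
    where
    open ≤-Reasoning
    f[xs]⊆ys : ∀ {y} → y ∈ map f xs → y ∈ _
    f[xs]⊆ys y∈ with ∈-map⁻ f y∈
    ... | x , x∈ , refl = into x∈

module _ {A B : Set} (_≟_ : DecidableEquality B) where

  ∑-fibres : ∀ {R : List B} (xs : List A) (key : A → B) (f : A → ℕ) → Unique R →
             (∀ {x} → x ∈ xs → key x ∈ R) →
             ∑ xs f ≡ ∑[ c ∈ R ] ∑[ x ∈ xs ] 𝟙 (does (key x ≟ c)) * f x
  ∑-fibres {R} xs key f u key∈R = begin
    ∑ xs f                                               ≡⟨ ∑-cong xs fibre-of ⟩
    ∑[ x ∈ xs ] ∑[ c ∈ R ] 𝟙 (does (key x ≟ c)) * f x   ≡⟨ ∑-comm xs R _ ⟩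
    ∑[ c ∈ R ] ∑[ x ∈ xs ] 𝟙 (does (key x ≟ c)) * f x   ∎
    where
    open ≡-Reasoning
    fibre-of : ∀ {x} → x ∈ xs → f x ≡ ∑[ c ∈ R ] 𝟙 (does (key x ≟ c)) * f x
    fibre-of {x} x∈ = sym (∑𝟙*-unique (λ c → does (key x ≟ c)) (λ _ → f x) u (key∈R x∈)
      (Equivalence.from (T-does (key x ≟ key x)) refl)
      (λ _ kx≡c → sym (Equivalence.to (T-does (key x ≟ _)) kx≡c)))

𝟙-does-* : ∀ {B : Set} (_≟_ : DecidableEquality B) a c (f : B → ℕ) →
           𝟙 (does (a ≟ c)) * f a ≡ 𝟙 (does (a ≟ c)) * f c
𝟙-does-* _≟_ a c f with a ≟ c
... | yes refl = refl
... | no  _    = refl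

-- Contents and partitions

module _ {i j i' j' : ℕ} where

  τ≡⇒+≡ : τ (i , j) ≡ τ (i' , j') → j + i' ≡ j' + i
  τ≡⇒+≡ e = ℤP.+-injective (begin
    ℤ.+ j ℤ.+ ℤ.+ i'                       ≡⟨ add-sub (ℤ.+ j) (ℤ.+ i) (ℤ.+ i') ⟩
    τ (i , j) ℤ.+ (ℤ.+ i ℤ.+ ℤ.+ i')       ≡⟨ cong (ℤ._+ (ℤ.+ i ℤ.+ ℤ.+ i')) e ⟩
    τ (i' , j') ℤ.+ (ℤ.+ i ℤ.+ ℤ.+ i')     ≡⟨ sub-add (ℤ.+ j') (ℤ.+ i') (ℤ.+ i) ⟩
    ℤ.+ j' ℤ.+ ℤ.+ i                       ∎)
    where
    open ≡-Reasoning
    add-sub : ∀ a b c → a ℤ.+ c ≡ (a - b) ℤ.+ (b ℤ.+ c)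
    add-sub = solve-∀
    sub-add : ∀ a c b → (a - c) ℤ.+ (b ℤ.+ c) ≡ a ℤ.+ b
    sub-add = solve-∀

  +≡⇒τ≡ : j + i' ≡ j' + i → τ (i , j) ≡ τ (i' , j')
  +≡⇒τ≡ e = begin
    ℤ.+ j - ℤ.+ i                              ≡⟨ cancel (ℤ.+ j) (ℤ.+ i) (ℤ.+ i') ⟨
    (ℤ.+ j ℤ.+ ℤ.+ i') - (ℤ.+ i ℤ.+ ℤ.+ i')    ≡⟨ cong₂ (λ m n → ℤ.+ m - ℤ.+ n) e (+-comm i i') ⟩
    (ℤ.+ j' ℤ.+ ℤ.+ i) - (ℤ.+ i' ℤ.+ ℤ.+ i)    ≡⟨ cancel (ℤ.+ j') (ℤ.+ i') (ℤ.+ i) ⟩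
    ℤ.+ j' - ℤ.+ i'                            ∎
    where
    open ≡-Reasoning
    cancel : ∀ a b c → (a ℤ.+ c) - (b ℤ.+ c) ≡ a - b
    cancel = solve-∀

τ-right : ∀ i j → τ (i , suc j) ≡ τ (i , j) ℤ.+ 1ℤ
τ-right i j = ≡-trans (cong (λ n → ℤ.+ n - ℤ.+ i) (+-comm 1 j)) (add-one (ℤ.+ j) (ℤ.+ i))
  where
  add-one : ∀ a b → (a ℤ.+ 1ℤ) - b ≡ (a - b) ℤ.+ 1ℤ
  add-one = solve-∀

τ-up : ∀ i j → τ (i , j) ≡ τ (suc i , j) ℤ.+ 1ℤ
τ-up i j = ≡-trans (sym (sub-one (ℤ.+ j) (ℤ.+ i))) (cong (λ n → ℤ.+ j - ℤ.+ n ℤ.+ 1ℤ) (+-comm i 1))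
  where
  sub-one : ∀ a b → a - (b ℤ.+ 1ℤ) ℤ.+ 1ℤ ≡ a - b
  sub-one = solve-∀

+1≡⇔≡-1 : ∀ {a c} → a ℤ.+ 1ℤ ≡ c ⇔ a ≡ c - 1ℤ
+1≡⇔≡-1 {a} {c} = mk⇔
  (λ a+1≡c → ≡-trans (sym (add-sub a)) (cong (_- 1ℤ) a+1≡c))
  (λ a≡c-1 → ≡-trans (cong (ℤ._+ 1ℤ) a≡c-1) (sub-add c))
  where
  add-sub : ∀ b → b ℤ.+ 1ℤ - 1ℤ ≡ b
  add-sub = solve-∀
  sub-add : ∀ b → b - 1ℤ ℤ.+ 1ℤ ≡ b
  sub-add = solve-∀

eqℤ-+1 : ∀ a c → eqℤ (a ℤ.+ 1ℤ) c ≡ eqℤ a (c - 1ℤ)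
eqℤ-+1 a c = does-⇔ +1≡⇔≡-1 (a ℤ.+ 1ℤ ℤP.≟ c) (a ℤP.≟ c - 1ℤ)

part-head : ∀ {x xs} → IsPartition (x ∷ xs) → part xs 1 ≤ x
part-head {xs = []}    _       = z≤n
part-head {xs = _ ∷ _} p = Linked.head p

part-antitone-suc : ∀ {xs} → IsPartition xs → ∀ {i k} → i ≤ k → part xs (suc k) ≤ part xs (suc i)
part-antitone-suc {[]}     _ _ = z≤n
part-antitone-suc {x ∷ xs} p {zero}  {zero}  _         = ≤-refl
part-antitone-suc {x ∷ xs} p {zero}  {suc k} _         = ≤-trans (part-antitone-suc (Linked.tail p) z≤n) (part-head p)
part-antitone-suc {x ∷ xs} p {suc i} {suc k} (s≤s i≤k) = part-antitone-suc (Linked.tail p) i≤k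

part-antitone : ∀ {xs} → IsPartition xs → ∀ {i k} → 1 ≤ i → i ≤ k → part xs k ≤ part xs i
part-antitone p {suc i} {suc k} _ (s≤s i≤k) = part-antitone-suc p i≤k

part-length : ∀ xs i → 1 ≤ part xs i → i ≤ length xs
part-length (x ∷ xs) zero          _  = z≤n
part-length (x ∷ xs) (suc zero)    _  = s≤s z≤n
part-length (x ∷ xs) (suc (suc i)) le = s≤s (part-length xs (suc i) le)

module _ {i j i' j' : ℕ} (same : τ (i , j) ≡ τ (i' , j')) where

  diagonal-≤ : i ≤ i' → j ≤ j'
  diagonal-≤ i≤i' = +-cancelʳ-≤ i j j' (subst (j + i ≤_) j+i'≡j'+i (+-monoʳ-≤ j i≤i'))
    where j+i'≡j'+i = τ≡⇒+≡ {i} {j} {i'} {j'} same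

  diagonal-< : i < i' → j < j'
  diagonal-< i<i' = +-cancelʳ-< i j j' (subst (j + i <_) j+i'≡j'+i (+-monoʳ-< j i<i'))
    where j+i'≡j'+i = τ≡⇒+≡ {i} {j} {i'} {j'} same

-- Geometry of a skew shape

Square-≟ : DecidableEquality Square
Square-≟ = ≡-dec ℕ._≟_ ℕ._≟_

module SkewShape (λ' μ : List ℕ) (λ-partition : IsPartition λ') (μ-partition : IsPartition μ) where

  record In (i j : ℕ) : Set where
    constructor box
    field
      1≤i  : 1 ≤ i
      1≤j  : 1 ≤ j
      j≤λᵢ : j ≤ part λ' i
      μᵢ<j : part μ i < j

  inSkew⇔In : ∀ {i j} → T (inSkew λ' μ i j) ⇔ In i j
  inSkew⇔In {i} {j} = mk⇔ to from
    where
    ≤ᵇ⇔ : ∀ {m n} → T (m ℕ.≤ᵇ n) ⇔ m ≤ n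
    ≤ᵇ⇔ {m} {n} = T-does (m ℕ.≤? n)
    to : T (inSkew λ' μ i j) → In i j
    to t with Equivalence.to T-∧ t
    ... | r , t₁ with Equivalence.to T-∧ t₁
    ... | c , t₂ with Equivalence.to T-∧ t₂
    ... | l , m = box (Equivalence.to ≤ᵇ⇔ r) (Equivalence.to ≤ᵇ⇔ c) (Equivalence.to ≤ᵇ⇔ l)
                      (≰⇒> (Equivalence.to (T-does (¬? (j ℕ.≤? part μ i))) m))
    from : In i j → T (inSkew λ' μ i j)
    from (box r c l m) = Equivalence.from T-∧ (Equivalence.from ≤ᵇ⇔ r , Equivalence.from T-∧
      (Equivalence.from ≤ᵇ⇔ c , Equivalence.from T-∧ (Equivalence.from ≤ᵇ⇔ l ,
       Equivalence.from (T-does (¬? (j ℕ.≤? part μ i))) (<⇒≱ m))))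

  ¬inSkew⇒¬In : ∀ {i j} → ¬ T (inSkew λ' μ i j) → ¬ In i j
  ¬inSkew⇒¬In ¬t ij = ¬t (Equivalence.from inSkew⇔In ij)

  In? : ∀ i j → Dec (In i j)
  In? i j = Dec.map inSkew⇔In (T? (inSkew λ' μ i j))

  ¬In-row0 : ∀ {j} → ¬ In 0 j
  ¬In-row0 (box () _ _ _)

  ¬In-col0 : ∀ {i} → ¬ In i 0
  ¬In-col0 (box _ () _ _)

  convex : ∀ {a b c d x y} → In a b → In c d → a ≤ x → x ≤ c → b ≤ y → y ≤ d → In x y
  convex (box 1≤a 1≤b _ μₐ<b) (box _ _ d≤λ_c _) a≤x x≤c b≤y y≤d = box
    (≤-trans 1≤a a≤x)
    (≤-trans 1≤b b≤y)
    (≤-trans y≤d (≤-trans d≤λ_c (part-antitone λ-partition (≤-trans 1≤a a≤x) x≤c)))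
    (<-≤-trans (≤-<-trans (part-antitone μ-partition 1≤a a≤x) μₐ<b) b≤y)

  row≤length : ∀ {i j} → In i j → i ≤ length λ'
  row≤length {i} (box _ 1≤j j≤λᵢ _) = part-length λ' i (≤-trans 1≤j j≤λᵢ)

  col≤λ₁ : ∀ {i j} → In i j → j ≤ part λ' 1
  col≤λ₁ (box 1≤i _ j≤λᵢ _) = ≤-trans j≤λᵢ (part-antitone λ-partition ≤-refl 1≤i)

  IsTop : ℕ → ℕ → Set
  IsTop i j = In i j × ¬ In (i ∸ 1) (j ∸ 1)

  top-above : ∀ {t u i j} → IsTop t u → In i j → τ (i , j) ≡ τ (t , u) → t ≤ i
  top-above {t} {u} {i} (tu , ¬pred) ij same with t ≤? i
  ... | yes t≤i = t≤i
  ... | no  t≰i = ⊥-elim (¬pred (convex ij tu (<⇒≤pred i<t) (m∸n≤m t 1)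
                                   (<⇒≤pred (diagonal-< same i<t)) (m∸n≤m u 1)))
    where
    i<t : i < t
    i<t = ≰⇒> t≰i

  top-unique : ∀ {t u t' u'} → IsTop t u → IsTop t' u' → τ (t , u) ≡ τ (t' , u') → (t , u) ≡ (t' , u')
  top-unique {t} {u} {t'} {u'} tu tu' same with ≤-antisym (top-above tu (proj₁ tu') (sym same))
                                                          (top-above tu' (proj₁ tu) same)
  ... | refl = cong (t ,_) (+-cancelʳ-≡ t u u' (τ≡⇒+≡ {t} {u} {t} {u'} same))

  top-exists : ∀ {i j} → In i j → ∃[ t ] ∃[ u ] IsTop t u × τ (t , u) ≡ τ (i , j)
  top-exists {zero}          ij = ⊥-elim (¬In-row0 ij)
  top-exists {suc i} {zero}  ij = ⊥-elim (¬In-col0 ij)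
  top-exists {suc i} {suc j} ij with In? i j
  ... | no ¬pred = suc i , suc j , (ij , ¬pred) , refl
  ... | yes pred with top-exists pred
  ... | t , u , top , same = t , u , top , ≡-trans same (+≡⇒τ≡ {i} {j} {suc i} {suc j} (+-suc j i))

  cells : List Square
  cells = cellsSkew λ' μ

  private
    rows : List ℕ
    rows = map suc (upTo (length λ'))

    columns : ℕ → List ℕ
    columns i = map suc (upTo (part λ' i))

    row : ℕ → List Square
    row i = map (i ,_) (filterB (inSkew λ' μ i) (columns i))

    cells≡concat-rows : cells ≡ concatMap row rows
    cells≡concat-rows = cong concat
      (map-cong (λ i → concatMap-if≡map-filterB (inSkew λ' μ i) (i ,_) (columns i)) rows)

    ∈row⇒row : ∀ {i x} → x ∈ row i → proj₁ x ≡ i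
    ∈row⇒row {i} x∈ with ∈-map⁻ (i ,_) x∈
    ... | _ , _ , refl = refl

    Unique-suc-upTo : ∀ n → Unique (map suc (upTo n))
    Unique-suc-upTo n = Unique.map⁺ suc-injective (Unique.upTo⁺ n)

    ∈suc-upTo : ∀ {n m} → 1 ≤ m → m ≤ n → m ∈ map suc (upTo n)
    ∈suc-upTo {m = suc m} _ m<n = ∈-map⁺ suc (∈-upTo⁺ m<n)

  Unique-cells : Unique cells
  Unique-cells = subst Unique (sym cells≡concat-rows) (Unique.concat⁺
    (All.map⁺ (All.universal (λ i → Unique.map⁺ ,-injectiveʳ
      (Unique-filterB (inSkew λ' μ i) (Unique-suc-upTo (part λ' i)))) rows))
    (AllPairs.map⁺ (AllPairs.map
      (λ i≢i' {_} (x∈ , x∈') → i≢i' (≡-trans (sym (∈row⇒row x∈)) (∈row⇒row x∈')))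
      (Unique-suc-upTo (length λ')))))

  ∈cells⇔In : ∀ {i j} → (i , j) ∈ cells ⇔ In i j
  ∈cells⇔In {i} {j} = mk⇔ to from
    where
    to : (i , j) ∈ cells → In i j
    to x∈ with ∈-concat⁻′ (map row rows) (subst ((i , j) ∈_) cells≡concat-rows x∈)
    ... | _ , x∈row , row∈ with ∈-map⁻ row row∈
    ... | i' , _ , refl with ∈-map⁻ (i' ,_) x∈row
    ... | j' , j'∈ , refl = Equivalence.to inSkew⇔In (proj₂ (∈-filterB⁻ (inSkew λ' μ i') (columns i') j'∈))
    from : In i j → (i , j) ∈ cells
    from ij@(box 1≤i 1≤j j≤λᵢ _) = subst ((i , j) ∈_) (sym cells≡concat-rows) (∈-concat⁺′
      (∈-map⁺ (i ,_) (∈-filterB⁺ (inSkew λ' μ i) (∈suc-upTo 1≤j j≤λᵢ) (Equivalence.from inSkew⇔In ij)))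
      (∈-map⁺ row (∈suc-upTo 1≤i (row≤length ij))))

  diagonal : ℤ → List Square
  diagonal c = filterB (λ x → eqℤ (τ x) c) cells

  diagonalSize : ℤ → ℕ
  diagonalSize c = length (diagonal c)

  Unique-diagonal : ∀ c → Unique (diagonal c)
  Unique-diagonal c = Unique-filterB (λ x → eqℤ (τ x) c) Unique-cells

  ∈diagonal⇔ : ∀ {c i j} → (i , j) ∈ diagonal c ⇔ (In i j × τ (i , j) ≡ c)
  ∈diagonal⇔ {c} {i} {j} = mk⇔
    (λ x∈ → let x∈cells , same = ∈-filterB⁻ (λ x → eqℤ (τ x) c) cells x∈
            in Equivalence.to ∈cells⇔In x∈cells , Equivalence.to (T-does (τ (i , j) ℤP.≟ c)) same)
    (λ (ij , same) → ∈-filterB⁺ (λ x → eqℤ (τ x) c) (Equivalence.from ∈cells⇔In ij)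
                                  (Equivalence.from (T-does (τ (i , j) ℤP.≟ c)) same))

  data DiagonalView (c : ℤ) : Set where
    empty : (∀ {i j} → In i j → τ (i , j) ≢ c) → DiagonalView c
    top   : ∀ {t u} → IsTop t u → τ (t , u) ≡ c → DiagonalView c

  diagonalView : ∀ c → DiagonalView c
  diagonalView c with any? (λ x → τ x ℤP.≟ c) cells
  ... | no none = empty (λ ij same → none (lose (Equivalence.from ∈cells⇔In ij) same))
  ... | yes some with find some
  ... | (i , j) , x∈ , same with top-exists (Equivalence.to ∈cells⇔In x∈)
  ... | t , u , tu , same′ = top tu (≡-trans same′ same)

  diagonalSize-empty : ∀ {c} → (∀ {i j} → In i j → τ (i , j) ≢ c) → diagonalSize c ≡ 0
  diagonalSize-empty {c} none with diagonal c in eq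
  ... | []    = refl
  ... | x ∷ _ = ⊥-elim (none ij same)
    where
    x∈ : x ∈ diagonal c
    x∈ = subst (x ∈_) (sym eq) (here refl)
    ij   = proj₁ (Equivalence.to ∈diagonal⇔ x∈)
    same = proj₂ (Equivalence.to ∈diagonal⇔ x∈)

  diagLen-top : ∀ {t u} → IsTop t u → diagLen λ' μ (t , u) ≡ diagonalSize (τ (t , u))
  diagLen-top {t} {u} tu = begin
    length offsets                      ≡⟨ length-map walk offsets ⟨
    length (map walk offsets)           ≡⟨ ↭-length (Unique-↭ Unique-walk (Unique-diagonal _) same-squares) ⟩
    diagonalSize (τ (t , u))       ∎
    where
    open ≡-Reasoning
    onDiagonal : ℕ → Bool
    onDiagonal p = inSkew λ' μ (t + p) (u + p)
    offsets : List ℕ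
    offsets = filterB onDiagonal (upTo (suc (length λ')))
    walk : ℕ → Square
    walk p = t + p , u + p
    Unique-walk : Unique (map walk offsets)
    Unique-walk = Unique.map⁺ (λ eq → +-cancelˡ-≡ t _ _ (,-injectiveˡ eq))
                                (Unique-filterB onDiagonal (Unique.upTo⁺ (suc (length λ'))))
    walk-content : ∀ p → τ (walk p) ≡ τ (t , u)
    walk-content p = +≡⇒τ≡ {t + p} {u + p} {t} {u} (≡-trans (+-assoc u p t) (cong (u +_) (+-comm p t)))
    same-squares : ∀ {x} → x ∈ map walk offsets ⇔ x ∈ diagonal (τ (t , u))
    same-squares = mk⇔ to from
      where
      to : ∀ {x} → x ∈ map walk offsets → x ∈ diagonal (τ (t , u))
      to x∈ with ∈-map⁻ walk x∈
      ... | p , p∈ , refl = Equivalence.from ∈diagonal⇔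
        (Equivalence.to inSkew⇔In (proj₂ (∈-filterB⁻ onDiagonal (upTo (suc (length λ'))) p∈)) , walk-content p)
      from : ∀ {x} → x ∈ diagonal (τ (t , u)) → x ∈ map walk offsets
      from {i , j} x∈ with Equivalence.to ∈diagonal⇔ x∈
      ... | ij , same = subst (_∈ map walk offsets) (sym (cong₂ _,_ i≡t+p j≡u+p))
        (∈-map⁺ walk (∈-filterB⁺ onDiagonal (∈-upTo⁺ (s≤s (≤-trans (m∸n≤m i t) (row≤length ij))))
          (Equivalence.from inSkew⇔In (subst₂ In i≡t+p j≡u+p ij))))
        where
        t≤i : t ≤ i
        t≤i = top-above tu ij same
        i≡t+p : i ≡ t + (i ∸ t)
        i≡t+p = sym (m+[n∸m]≡n t≤i)
        j≡u+p : j ≡ u + (i ∸ t)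
        j≡u+p = +-cancelʳ-≡ t j (u + (i ∸ t)) (begin
          j + t            ≡⟨ τ≡⇒+≡ {i} {j} {t} {u} same ⟩
          u + i            ≡⟨ cong (u +_) i≡t+p ⟩
          u + (t + (i ∸ t)) ≡⟨ cong (u +_) (+-comm t _) ⟩
          u + ((i ∸ t) + t) ≡⟨ +-assoc u _ t ⟨
          u + (i ∸ t) + t  ∎)

  left-closed : ∀ {t u i j} → IsTop t u → In t (u ∸ 1) → In i j → τ (i , j) ≡ τ (t , u) → In i (j ∸ 1)
  left-closed tu left ij same =
    convex left ij t≤i ≤-refl (∸-monoˡ-≤ 1 (diagonal-≤ (sym same) t≤i)) (m∸n≤m _ 1)
    where t≤i = top-above tu ij same

  up-closed : ∀ {t u i j} → IsTop t u → In (t ∸ 1) u → In i j → τ (i , j) ≡ τ (t , u) → In (i ∸ 1) j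
  up-closed tu above ij same =
    convex above ij (∸-monoˡ-≤ 1 t≤i) (m∸n≤m _ 1) (diagonal-≤ (sym same) t≤i) ≤-refl
    where t≤i = top-above tu ij same

  left⇒¬up : ∀ {t u t' u'} → IsTop t u → In t (u ∸ 1) → IsTop t' u' →
             τ (t' , u') ℤ.+ 1ℤ ≡ τ (t , u) → ¬ In (t' ∸ 1) u'
  left⇒¬up {t} {zero}  _  left _ _ _ = ¬In-col0 left
  left⇒¬up {t} {suc u} {zero} _ _ top' _ _ = ¬In-row0 (proj₁ top')
  left⇒¬up {t} {suc u} {suc t'} {u'} tu left top' adjacent above = <⇒≱ t'<t (top-above tu above up-content)
    where
    left-content : τ (t , u) ≡ τ (suc t' , u')
    left-content = ≡-trans (Equivalence.to +1≡⇔≡-1 (sym (τ-right t u)))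
                           (sym (Equivalence.to +1≡⇔≡-1 adjacent))
    t'<t : t' < t
    t'<t = top-above top' left left-content
    up-content : τ (t' , u') ≡ τ (t , suc u)
    up-content = ≡-trans (τ-up t' u') adjacent

  ¬left⇒up : ∀ {t u t' u'} → IsTop t u → ¬ In t (u ∸ 1) → IsTop t' u' →
             τ (t' , u') ℤ.+ 1ℤ ≡ τ (t , u) → In (t' ∸ 1) u'
  ¬left⇒up {t} {u} {t'} {u'} tu ¬left top' adjacent with t <? t'
  ... | yes t<t'@(s≤s _) = convex (proj₁ tu) (proj₁ top') (<⇒≤pred t<t') (m∸n≤m t' 1) u≤u' ≤-refl
    where
    u≤u' : u ≤ u'
    u≤u' = diagonal-≤ (sym (≡-trans (τ-up _ u') adjacent)) (<⇒≤pred t<t')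
  ... | no  t≮t' =
    ⊥-elim (¬left (convex (proj₁ top') (proj₁ tu) t'≤t ≤-refl (<⇒≤pred u'<u) (m∸n≤m u 1)))
    where
    t'≤t : t' ≤ t
    t'≤t = ≮⇒≥ t≮t'
    u'<u : u' < u
    u'<u = diagonal-≤ (≡-trans (τ-right t' u') adjacent) t'≤t

  private
    ∸1-injective : ∀ {m n} → 1 ≤ m → 1 ≤ n → m ∸ 1 ≡ n ∸ 1 → m ≡ n
    ∸1-injective (s≤s _) (s≤s _) = cong suc

  diagonalSize-left-≤ : ∀ {t u} → IsTop t u → In t (u ∸ 1) →
                           diagonalSize (τ (t , u)) ≤ diagonalSize (τ (t , u) - 1ℤ)
  diagonalSize-left-≤ {t} {u} tu left =
    length≤-injection Square-≟ shift (Unique-diagonal _) (Unique-diagonal _) injective into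
    where
    shift : Square → Square
    shift (i , j) = i , j ∸ 1
    injective : ∀ {x y} → x ∈ diagonal (τ (t , u)) → y ∈ diagonal (τ (t , u)) → shift x ≡ shift y → x ≡ y
    injective {i , j} {i' , j'} x∈ y∈ eq = cong₂ _,_ (,-injectiveˡ eq)
      (∸1-injective (In.1≤j (proj₁ (Equivalence.to ∈diagonal⇔ x∈)))
                    (In.1≤j (proj₁ (Equivalence.to ∈diagonal⇔ y∈))) (,-injectiveʳ eq))
    into : ∀ {x} → x ∈ diagonal (τ (t , u)) → shift x ∈ diagonal (τ (t , u) - 1ℤ)
    into {i , j} x∈ with Equivalence.to ∈diagonal⇔ x∈
    ... | ij@(box _ (s≤s _) _ _) , same = Equivalence.from ∈diagonal⇔
      (left-closed tu left ij same , Equivalence.to +1≡⇔≡-1 (≡-trans (sym (τ-right i _)) same))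

  diagonalSize-up-≤ : ∀ {t u} → IsTop t u → In (t ∸ 1) u →
                         diagonalSize (τ (t , u)) ≤ diagonalSize (τ (t , u) ℤ.+ 1ℤ)
  diagonalSize-up-≤ {t} {u} tu above =
    length≤-injection Square-≟ shift (Unique-diagonal _) (Unique-diagonal _) injective into
    where
    shift : Square → Square
    shift (i , j) = i ∸ 1 , j
    injective : ∀ {x y} → x ∈ diagonal (τ (t , u)) → y ∈ diagonal (τ (t , u)) → shift x ≡ shift y → x ≡ y
    injective {i , j} {i' , j'} x∈ y∈ eq = cong₂ _,_
      (∸1-injective (In.1≤i (proj₁ (Equivalence.to ∈diagonal⇔ x∈)))
                    (In.1≤i (proj₁ (Equivalence.to ∈diagonal⇔ y∈))) (,-injectiveˡ eq))
      (,-injectiveʳ eq)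
    into : ∀ {x} → x ∈ diagonal (τ (t , u)) → shift x ∈ diagonal (τ (t , u) ℤ.+ 1ℤ)
    into {i , j} x∈ with Equivalence.to ∈diagonal⇔ x∈
    ... | ij@(box (s≤s _) _ _ _) , same = Equivalence.from ∈diagonal⇔
      (up-closed tu above ij same , ≡-trans (τ-up _ j) (cong (ℤ._+ 1ℤ) same))

  contents⁺ : List ℤ
  contents⁺ = deduplicate ℤP._≟_ (map τ cells ++ map (λ x → τ x ℤ.+ 1ℤ) cells)

  Unique-contents⁺ : Unique contents⁺
  Unique-contents⁺ = deduplicate-! ℤP._≟_ _

  τ∈contents⁺ : ∀ {x} → x ∈ cells → τ x ∈ contents⁺
  τ∈contents⁺ x∈ = ∈-deduplicate⁺ ℤP._≟_ (∈-++⁺ˡ (∈-map⁺ τ x∈))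

  τ+1∈contents⁺ : ∀ {x} → x ∈ cells → τ x ℤ.+ 1ℤ ∈ contents⁺
  τ+1∈contents⁺ x∈ =
    ∈-deduplicate⁺ ℤP._≟_ (∈-++⁺ʳ (map τ cells) (∈-map⁺ (λ x → τ x ℤ.+ 1ℤ) x∈))

  τ∈contents : ∀ {i j} → In i j → τ (i , j) ∈ contents λ' μ
  τ∈contents {i} {j} ij = ∈-filterB⁺ (λ c → any (λ s → eqℤ (τ s) c) cells)
    (subst (_∈ _) (sym τ≡shifted) (∈-map⁺ (λ t → ℤ.+ t - ℤ.+ length λ') (∈-upTo⁺ (s≤s shift≤))))
    (any⁺ (λ s → eqℤ (τ s) (τ (i , j))) (lose (Equivalence.from ∈cells⇔In ij)
                                              (Equivalence.from (T-does (τ (i , j) ℤP.≟ τ (i , j))) refl)))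
    where
    ℓ = length λ'
    i≤ℓ : i ≤ ℓ
    i≤ℓ = row≤length ij
    τ≡shifted : τ (i , j) ≡ ℤ.+ (j + (ℓ ∸ i)) - ℤ.+ ℓ
    τ≡shifted = +≡⇒τ≡ {i} {j} {ℓ} {j + (ℓ ∸ i)}
      (≡-trans (cong (j +_) (sym (m∸n+n≡m i≤ℓ))) (sym (+-assoc j (ℓ ∸ i) i)))
    shift≤ : j + (ℓ ∸ i) ≤ ℓ + part λ' 1
    shift≤ = ≤-trans (+-mono-≤ (col≤λ₁ ij) (m∸n≤m ℓ i)) (≤-reflexive (+-comm (part λ' 1) ℓ))

  excess : ℕ
  excess = ∑[ c ∈ contents⁺ ] (diagonalSize c ∸ diagonalSize (c - 1ℤ))

  StartSquare EndSquare : Square → Set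
  StartSquare (i , j) = In i j × (¬ In i (j ∸ 1) ⊎ ¬ In (suc i) j)
  EndSquare   (i , j) = In i j × (¬ In i (suc j) ⊎ ¬ In (i ∸ 1) j)

  private
    -- Convexity fills the rectangle spanned by two start squares of one diagonal; this
    -- forces the upper one to lack a left neighbour and the lower one a bottom neighbour,
    -- and then an end square on the previous diagonal has nowhere to lie.
    no-end-between-starts : ∀ {r₁ j₁ r₂ j₂ r j} → r₁ < r₂ → τ (r₁ , j₁) ≡ τ (r₂ , j₂) →
                            StartSquare (r₁ , j₁) → StartSquare (r₂ , j₂) →
                            EndSquare (r , j) → τ (r , j) ℤ.+ 1ℤ ≡ τ (r₁ , j₁) → ⊥
    no-end-between-starts {r₁} {j₁} {r₂} {j₂} {r} {j} r₁<r₂ same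
                          (a , a-start) (b , b-start) (y , y-end) adjacent =
      position (r ≤? r₁) (r₂ <? r)
      where
      j₁<j₂ : j₁ < j₂
      j₁<j₂ = diagonal-< same r₁<r₂
      ¬left : ¬ In r₁ (j₁ ∸ 1)
      ¬left = [ id , (λ ¬below _ → ¬below (convex a b (n≤1+n r₁) r₁<r₂ ≤-refl (<⇒≤ j₁<j₂))) ]′
                a-start
      ¬below : ¬ In (suc r₂) j₂
      ¬below = [ (λ ¬left _ → ¬left (convex a b (<⇒≤ r₁<r₂) ≤-refl (<⇒≤pred j₁<j₂) (m∸n≤m j₂ 1))) , id ]′
                 b-start
      right-content : τ (r , suc j) ≡ τ (r₁ , j₁)
      right-content = ≡-trans (τ-right r j) adjacent
      between : r₁ < r → r ≤ r₂ → ⊥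
      between r₁<r r≤r₂ =
        [ (λ ¬right → ¬right (convex a b (<⇒≤ r₁<r) r≤r₂ (<⇒≤ j₁<1+j) 1+j≤j₂))
        , (λ ¬above → ¬above (convex a b (<⇒≤pred r₁<r) (≤-trans (m∸n≤m r 1) r≤r₂)
                                     (≤-pred j₁<1+j) (≤-trans (n≤1+n j) 1+j≤j₂)))
        ]′ y-end
        where
        j₁<1+j : j₁ < suc j
        j₁<1+j = diagonal-< (sym right-content) r₁<r
        1+j≤j₂ : suc j ≤ j₂
        1+j≤j₂ = diagonal-≤ (≡-trans right-content same) r≤r₂
      position : Dec (r ≤ r₁) → Dec (r₂ < r) → ⊥
      position (yes r≤r₁) _ =
        ¬left (convex y a r≤r₁ ≤-refl (<⇒≤pred (diagonal-≤ right-content r≤r₁)) (m∸n≤m j₁ 1))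
      position (no _) (yes r₂<r) =
        ¬below (convex b y (n≤1+n r₂) r₂<r ≤-refl
                       (≤-pred (diagonal-< (≡-trans (sym same) (sym right-content)) r₂<r)))
      position (no r≰r₁) (no r₂≮r) = between (≰⇒> r≰r₁) (≮⇒≥ r₂≮r)

  start-unique : ∀ {a b y} → StartSquare a → StartSquare b → τ a ≡ τ b →
                 EndSquare y → τ y ℤ.+ 1ℤ ≡ τ a → a ≡ b
  start-unique {r₁ , j₁} {r₂ , j₂} a b same y adjacent with <-cmp r₁ r₂
  ... | tri< r₁<r₂ _ _ = ⊥-elim (no-end-between-starts r₁<r₂ same a b y adjacent)
  ... | tri> _ _ r₂<r₁ = ⊥-elim (no-end-between-starts r₂<r₁ (sym same) b a y (≡-trans adjacent same))
  ... | tri≈ _ refl _  = cong (r₁ ,_) (+-cancelʳ-≡ r₁ j₁ j₂ (τ≡⇒+≡ {r₁} {j₁} {r₁} {j₂} same))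

-- The rank

module Rank (λ' μ : List ℕ) (λ-partition : IsPartition λ') (μ-partition : IsPartition μ) where

  open SkewShape λ' μ λ-partition μ-partition

  isTop hasLeft hasAbove : Square → Bool
  isTop (i , j)    = inSkew λ' μ i j ∧ not (inSkew λ' μ (i ∸ 1) (j ∸ 1))
  hasLeft (i , j)  = inSkew λ' μ i (j ∸ 1)
  hasAbove (i , j) = inSkew λ' μ (i ∸ 1) j

  T-isTop⇔ : ∀ {i j} → T (isTop (i , j)) ⇔ IsTop i j
  T-isTop⇔ {i} {j} = mk⇔
    (λ t → let ij , ¬pred = Equivalence.to T-∧ t in
      Equivalence.to inSkew⇔In ij , ¬inSkew⇒¬In (Equivalence.to T-not⇔¬T ¬pred))
    (λ (ij , ¬pred) → Equivalence.from T-∧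
      (Equivalence.from inSkew⇔In ij ,
       Equivalence.from T-not⇔¬T (λ pred → ¬pred (Equivalence.to inSkew⇔In pred))))

  -- Only tops of diagonals can be corners: a top is an outer corner iff it has neither
  -- a left nor an upper neighbour, and an inner corner iff it has both.
  corner-count : ∀ x → 𝟙 (isOuterCorner λ' μ x) + 𝟙 (isTop x) * 𝟙 (hasLeft x) + 𝟙 (isTop x) * 𝟙 (hasAbove x)
                       ≡ 𝟙 (isTop x) + 𝟙 (isInnerCorner λ' μ x)
  corner-count (i , j) =
    count (inSkew λ' μ i j) (inSkew λ' μ (i ∸ 1) (j ∸ 1)) (inSkew λ' μ i (j ∸ 1)) (inSkew λ' μ (i ∸ 1) j)
    where
    count : ∀ a d l u → 𝟙 (a ∧ not d ∧ not l ∧ not u) + 𝟙 (a ∧ not d) * 𝟙 l + 𝟙 (a ∧ not d) * 𝟙 u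
                        ≡ 𝟙 (a ∧ not d) + 𝟙 (a ∧ l ∧ u ∧ not d)
    count false _     _     _     = refl
    count true  true  false _     = refl
    count true  true  true  false = refl
    count true  true  true  true  = refl
    count true  false false false = refl
    count true  false false true  = refl
    count true  false true  false = refl
    count true  false true  true  = refl

  topWeight : ℤ → (Square → ℕ) → ℕ
  topWeight c g = ∑[ x ∈ cells ] 𝟙 (eqℤ (τ x) c ∧ isTop x) * g x

  topWeight-top : ∀ {c t u} (g : Square → ℕ) → IsTop t u → τ (t , u) ≡ c → topWeight c g ≡ g (t , u)
  topWeight-top {c} {t} {u} g tu same = ∑𝟙*-unique (λ x → eqℤ (τ x) c ∧ isTop x) g Unique-cells
    (Equivalence.from ∈cells⇔In (proj₁ tu))
    (Equivalence.from T-∧ (Equivalence.from (T-does (τ (t , u) ℤP.≟ c)) same , Equivalence.from T-isTop⇔ tu))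
    only
    where
    only : ∀ {y} → y ∈ cells → T (eqℤ (τ y) c ∧ isTop y) → y ≡ (t , u)
    only {i , j} _ t = let same′ , top′ = Equivalence.to T-∧ t in
      top-unique (Equivalence.to T-isTop⇔ top′) tu
        (≡-trans (Equivalence.to (T-does (τ (i , j) ℤP.≟ c)) same′) (sym same))

  topWeight-empty : ∀ {c} (g : Square → ℕ) → (∀ {i j} → In i j → τ (i , j) ≢ c) → topWeight c g ≡ 0
  topWeight-empty {c} g none = ∑-≡0 vanishes
    where
    vanishes : ∀ {x} → x ∈ cells → 𝟙 (eqℤ (τ x) c ∧ isTop x) * g x ≡ 0
    vanishes {i , j} x∈ = cong (_* g (i , j)) (𝟙-false (λ t → none (Equivalence.to ∈cells⇔In x∈)
      (Equivalence.to (T-does (τ (i , j) ℤP.≟ c)) (proj₁ (Equivalence.to T-∧ t)))))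

  onTop : (Square → ℕ) → Square → ℕ
  onTop g x = 𝟙 (isTop x) * g x

  topSum : (Square → ℕ) → ℕ
  topSum g = ∑ cells (onTop g)

  ∑-tops : ∀ g → topSum g ≡ ∑[ c ∈ contents⁺ ] topWeight c g
  ∑-tops g = ≡-trans (∑-fibres ℤP._≟_ cells τ _ Unique-contents⁺ τ∈contents⁺)
    (∑-cong contents⁺ (λ {c} _ → ∑-cong cells (λ {x} _ → 𝟙-∧-* (eqℤ (τ x) c) (isTop x) (g x))))

  ∑-tops-1 : ∀ g → topSum g ≡ ∑[ c ∈ contents⁺ ] topWeight (c - 1ℤ) g
  ∑-tops-1 g = ≡-trans (∑-fibres ℤP._≟_ cells (λ x → τ x ℤ.+ 1ℤ) _ Unique-contents⁺ τ+1∈contents⁺)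
    (∑-cong contents⁺ (λ {c} _ → ∑-cong cells (λ {x} _ →
      ≡-trans (cong (λ b → 𝟙 b * _) (eqℤ-+1 (τ x) c)) (𝟙-∧-* (eqℤ (τ x) (c - 1ℤ)) (isTop x) (g x)))))

  topWeight-diagLen : ∀ c → topWeight c (diagLen λ' μ) ≡ diagonalSize c
  topWeight-diagLen c with diagonalView c
  ... | empty none  = ≡-trans (topWeight-empty _ none) (sym (diagonalSize-empty none))
  ... | top tu refl = ≡-trans (topWeight-top _ tu refl) (diagLen-top tu)

  topWeight-neighbour : ∀ {c t u} (has : Square → Bool) → IsTop t u → τ (t , u) ≡ c →
                        topWeight c (λ x → 𝟙 (has x) * diagLen λ' μ x) ≡ 𝟙 (has (t , u)) * diagonalSize c
  topWeight-neighbour has tu refl = ≡-trans (topWeight-top _ tu refl) (cong (𝟙 (has _) *_) (diagLen-top tu))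

  leftWeight aboveWeight : Square → ℕ
  leftWeight x  = 𝟙 (hasLeft x) * diagLen λ' μ x
  aboveWeight x = 𝟙 (hasAbove x) * diagLen λ' μ x

  -- The top of diagonal c has a left neighbour iff the top of diagonal c − 1 has no upper
  -- one, and the diagonal holding the neighbour is the longer of the two.
  neighbourWeights≡min-tops : ∀ {t u t' u'} → IsTop t u → IsTop t' u' → τ (t' , u') ℤ.+ 1ℤ ≡ τ (t , u) →
                              topWeight (τ (t , u)) leftWeight + topWeight (τ (t , u) - 1ℤ) aboveWeight
                              ≡ diagonalSize (τ (t , u) - 1ℤ) ⊓ diagonalSize (τ (t , u))
  neighbourWeights≡min-tops {t} {u} {t'} {u'} tu top' adjacent
    rewrite topWeight-neighbour hasLeft tu refl
          | topWeight-neighbour hasAbove top' (Equivalence.to +1≡⇔≡-1 adjacent)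
    with In? t (u ∸ 1)
  ... | yes left
    rewrite 𝟙-true (Equivalence.from inSkew⇔In left)
          | 𝟙-false (λ above → left⇒¬up tu left top' adjacent (Equivalence.to inSkew⇔In above))
          = ≡-trans (+-identityʳ _) (≡-trans (*-identityˡ _) (sym (m≥n⇒m⊓n≡n (diagonalSize-left-≤ tu left))))
  ... | no ¬left
    rewrite 𝟙-false (λ left → ¬left (Equivalence.to inSkew⇔In left))
          | 𝟙-true (Equivalence.from inSkew⇔In (¬left⇒up tu ¬left top' adjacent))
          = ≡-trans (*-identityˡ _) (sym (m≤n⇒m⊓n≡m
              (subst₂ (λ a b → diagonalSize a ≤ diagonalSize b)
                      (Equivalence.to +1≡⇔≡-1 adjacent) adjacent
                      (diagonalSize-up-≤ top' (¬left⇒up tu ¬left top' adjacent)))))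

  neighbourWeights≡min : ∀ c → topWeight c leftWeight + topWeight (c - 1ℤ) aboveWeight
                               ≡ diagonalSize (c - 1ℤ) ⊓ diagonalSize c
  neighbourWeights≡min c with diagonalView c | diagonalView (c - 1ℤ)
  ... | empty none | view = begin
    topWeight c leftWeight + topWeight (c - 1ℤ) aboveWeight
      ≡⟨ cong₂ _+_ (topWeight-empty _ none) (no-above view) ⟩
    0
      ≡⟨ ⊓-zeroʳ _ ⟨
    diagonalSize (c - 1ℤ) ⊓ 0
      ≡⟨ cong (diagonalSize (c - 1ℤ) ⊓_) (diagonalSize-empty none) ⟨
    diagonalSize (c - 1ℤ) ⊓ diagonalSize c
      ∎
    where
    open ≡-Reasoning
    no-above : DiagonalView (c - 1ℤ) → topWeight (c - 1ℤ) aboveWeight ≡ 0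
    no-above (empty none′) = topWeight-empty _ none′
    no-above (top {zero} top' _) = ⊥-elim (¬In-row0 (proj₁ top'))
    no-above (top {suc t'} {u'} top' same) = ≡-trans (topWeight-neighbour hasAbove top' same)
      (cong (_* diagonalSize (c - 1ℤ)) (𝟙-false {hasAbove (suc t' , u')} (λ above →
        none (Equivalence.to (inSkew⇔In {t'} {u'}) above)
             (≡-trans (τ-up t' u') (Equivalence.from (+1≡⇔≡-1 {τ (suc t' , u')}) same)))))
  ... | top {t} {zero} tu _ | _ = ⊥-elim (¬In-col0 (proj₁ tu))
  ... | top {t} {suc u} tu same | empty none = begin
    topWeight c leftWeight + topWeight (c - 1ℤ) aboveWeight
      ≡⟨ cong₂ _+_ no-left (topWeight-empty _ none) ⟩
    0
      ≡⟨ cong (_⊓ diagonalSize c) (diagonalSize-empty none) ⟨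
    diagonalSize (c - 1ℤ) ⊓ diagonalSize c
      ∎
    where
    open ≡-Reasoning
    no-left : topWeight c leftWeight ≡ 0
    no-left = ≡-trans (topWeight-neighbour hasLeft tu same)
      (cong (_* diagonalSize c) (𝟙-false {hasLeft (t , suc u)} (λ left →
        none (Equivalence.to (inSkew⇔In {t} {u}) left)
             (Equivalence.to (+1≡⇔≡-1 {τ (t , u)}) (≡-trans (sym (τ-right t u)) same)))))
  ... | top tu refl | top top' same' = neighbourWeights≡min-tops tu top' (Equivalence.from +1≡⇔≡-1 same')

  private
    minima : ℕ
    minima = ∑[ c ∈ contents⁺ ] (diagonalSize (c - 1ℤ) ⊓ diagonalSize c)

    ∑-tops-by-corners : dPlus λ' μ + (topSum leftWeight + topSum aboveWeight) ≡ topSum (diagLen λ' μ) + dMinus λ' μ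
    ∑-tops-by-corners = begin
      dPlus λ' μ + (topSum leftWeight + topSum aboveWeight)
        ≡⟨ cong₂ _+_ (sum-map-filterB (isOuterCorner λ' μ) d cells) (sym (∑-+ cells _ _)) ⟩
      ∑ cells outer + ∑ cells (λ x → onTop leftWeight x + onTop aboveWeight x)
        ≡⟨ ∑-+ cells _ _ ⟨
      ∑ cells (λ x → outer x + (onTop leftWeight x + onTop aboveWeight x))
        ≡⟨ ∑-cong cells (λ {x} _ → weighted-corner-count x) ⟩
      ∑ cells (λ x → onTop d x + inner x)
        ≡⟨ ∑-+ cells _ _ ⟩
      topSum d + ∑ cells inner
        ≡⟨ cong (topSum d +_) (sum-map-filterB (isInnerCorner λ' μ) d cells) ⟨
      topSum d + dMinus λ' μ
        ∎
      where
      open ≡-Reasoning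
      d outer inner : Square → ℕ
      d = diagLen λ' μ
      outer x = 𝟙 (isOuterCorner λ' μ x) * d x
      inner x = 𝟙 (isInnerCorner λ' μ x) * d x
      weighted-corner-count : ∀ x → outer x + (onTop leftWeight x + onTop aboveWeight x) ≡ onTop d x + inner x
      weighted-corner-count x = begin
        outer x + (onTop leftWeight x + onTop aboveWeight x)
          ≡⟨ factor (𝟙 (isOuterCorner λ' μ x)) (𝟙 (isTop x)) (𝟙 (hasLeft x)) (𝟙 (hasAbove x)) (d x) ⟩
        (𝟙 (isOuterCorner λ' μ x) + 𝟙 (isTop x) * 𝟙 (hasLeft x) + 𝟙 (isTop x) * 𝟙 (hasAbove x)) * d x
          ≡⟨ cong (_* d x) (corner-count x) ⟩
        (𝟙 (isTop x) + 𝟙 (isInnerCorner λ' μ x)) * d x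
          ≡⟨ *-distribʳ-+ (d x) (𝟙 (isTop x)) _ ⟩
        onTop d x + inner x
          ∎
        where
        factor : ∀ o t l a d → o * d + (t * (l * d) + t * (a * d)) ≡ (o + t * l + t * a) * d
        factor = ℕ-solve-∀

    ∑-tops-diagLen : topSum (diagLen λ' μ) ≡ minima + excess
    ∑-tops-diagLen = begin
      topSum (diagLen λ' μ)
        ≡⟨ ∑-tops (diagLen λ' μ) ⟩
      ∑ contents⁺ (λ c → topWeight c (diagLen λ' μ))
        ≡⟨ ∑-cong contents⁺ (λ {c} _ → topWeight-diagLen c) ⟩
      ∑ contents⁺ diagonalSize
        ≡⟨ ∑-cong contents⁺ (λ {c} _ → m⊓n+n∸m≡n (diagonalSize (c - 1ℤ)) _) ⟨
      ∑ contents⁺ (λ c → diagonalSize (c - 1ℤ) ⊓ diagonalSize c + (diagonalSize c ∸ diagonalSize (c - 1ℤ)))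
        ≡⟨ ∑-+ contents⁺ _ _ ⟩
      minima + excess
        ∎
      where open ≡-Reasoning

    ∑-tops-neighbours : topSum leftWeight + topSum aboveWeight ≡ minima
    ∑-tops-neighbours = begin
      topSum leftWeight + topSum aboveWeight
        ≡⟨ cong₂ _+_ (∑-tops leftWeight) (∑-tops-1 aboveWeight) ⟩
      ∑ contents⁺ (λ c → topWeight c leftWeight) + ∑ contents⁺ (λ c → topWeight (c - 1ℤ) aboveWeight)
        ≡⟨ ∑-+ contents⁺ _ _ ⟨
      ∑ contents⁺ (λ c → topWeight c leftWeight + topWeight (c - 1ℤ) aboveWeight)
        ≡⟨ ∑-cong contents⁺ (λ {c} _ → neighbourWeights≡min c) ⟩
      minima
        ∎
      where open ≡-Reasoning

  dPlus≡excess+dMinus : dPlus λ' μ ≡ excess + dMinus λ' μ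
  dPlus≡excess+dMinus = +-cancelʳ-≡ minima _ _ (begin
    dPlus λ' μ + minima                  ≡⟨ cong (dPlus λ' μ +_) ∑-tops-neighbours ⟨
    dPlus λ' μ + (topSum leftWeight + topSum aboveWeight)  ≡⟨ ∑-tops-by-corners ⟩
    topSum (diagLen λ' μ) + dMinus λ' μ  ≡⟨ cong (_+ dMinus λ' μ) ∑-tops-diagLen ⟩
    minima + excess + dMinus λ' μ        ≡⟨ +-assoc minima excess _ ⟩
    minima + (excess + dMinus λ' μ)      ≡⟨ +-comm minima _ ⟩
    excess + dMinus λ' μ + minima        ∎)
    where open ≡-Reasoning

  rank≡excess : rank λ' μ ≡ ℤ.+ excess
  rank≡excess = begin
    ℤ.+ dPlus λ' μ - ℤ.+ dMinus λ' μ                  ≡⟨ cong (λ n → ℤ.+ n - ℤ.+ dMinus λ' μ) dPlus≡excess+dMinus ⟩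
    ℤ.+ excess ℤ.+ ℤ.+ dMinus λ' μ - ℤ.+ dMinus λ' μ  ≡⟨ add-sub (ℤ.+ excess) (ℤ.+ dMinus λ' μ) ⟩
    ℤ.+ excess                                        ∎
    where
    open ≡-Reasoning
    add-sub : ∀ a b → a ℤ.+ b - b ≡ a
    add-sub = solve-∀

-- Border strips and the cutting strip

last-∷ : ∀ {A : Set} (x y : A) ys → last (x ∷ y ∷ ys) ≡ last (y ∷ ys)
last-∷ x y ys with initLast ys
... | []       = refl
... | _ ∷ʳ′ _ = refl

last-∈ : ∀ {A : Set} (x : A) xs → last (x ∷ xs) ∈ x ∷ xs
last-∈ x []       = here refl
last-∈ x (y ∷ ys) = subst (_∈ x ∷ y ∷ ys) (sym (last-∷ x y ys)) (there (last-∈ y ys))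

Step⇒τ+1 : ∀ {x y} → Step x y → τ y ≡ τ x ℤ.+ 1ℤ
Step⇒τ+1 {i , j} (inj₁ (refl , refl)) = τ-up _ j
Step⇒τ+1 {i , j} (inj₂ (refl , refl)) = τ-right i j

countContent : ℤ → List Square → ℕ
countContent c zs = ∑[ z ∈ zs ] 𝟙 (eqℤ (τ z) c)

strip-balance : ∀ c x xs → Linked Step (x ∷ xs) →
                𝟙 (eqℤ (τ x) c) + countContent (c - 1ℤ) (x ∷ xs)
                ≡ countContent c (x ∷ xs) + 𝟙 (eqℤ (τ (last (x ∷ xs))) (c - 1ℤ))
strip-balance c x []       _              = +0-swap (𝟙 (eqℤ (τ x) c)) (𝟙 (eqℤ (τ x) (c - 1ℤ)))
  where
  +0-swap : ∀ a b → a + (b + 0) ≡ a + 0 + b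
  +0-swap = ℕ-solve-∀
strip-balance c x (y ∷ ys) (step ∷ steps) = begin
  𝟙 (eqℤ (τ x) c) + (𝟙 (eqℤ (τ x) (c - 1ℤ)) + countContent (c - 1ℤ) (y ∷ ys))
    ≡⟨ cong (λ b → 𝟙 (eqℤ (τ x) c) + (𝟙 b + countContent (c - 1ℤ) (y ∷ ys))) entering ⟨
  𝟙 (eqℤ (τ x) c) + (𝟙 (eqℤ (τ y) c) + countContent (c - 1ℤ) (y ∷ ys))
    ≡⟨ cong (𝟙 (eqℤ (τ x) c) +_) (strip-balance c y ys steps) ⟩
  𝟙 (eqℤ (τ x) c) + (countContent c (y ∷ ys) + 𝟙 (eqℤ (τ (last (y ∷ ys))) (c - 1ℤ)))
    ≡⟨ +-assoc (𝟙 (eqℤ (τ x) c)) _ _ ⟨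
  countContent c (x ∷ y ∷ ys) + 𝟙 (eqℤ (τ (last (y ∷ ys))) (c - 1ℤ))
    ≡⟨ cong (λ z → countContent c (x ∷ y ∷ ys) + 𝟙 (eqℤ (τ z) (c - 1ℤ))) (last-∷ x y ys) ⟨
  countContent c (x ∷ y ∷ ys) + 𝟙 (eqℤ (τ (last (x ∷ y ∷ ys))) (c - 1ℤ))
    ∎
  where
  open ≡-Reasoning
  entering : eqℤ (τ y) c ≡ eqℤ (τ x) (c - 1ℤ)
  entering = ≡-trans (cong (λ a → eqℤ a c) (Step⇒τ+1 step)) (eqℤ-+1 (τ x) c)

i<i+1 : ∀ i → i ℤ.< i ℤ.+ 1ℤ
i<i+1 i = subst (ℤ._< i ℤ.+ 1ℤ) (ℤP.+-identityʳ i) (ℤP.+-monoʳ-< i (ℤ.+<+ (s≤s z≤n)))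

∣tabulate∘lookup∣ : ∀ {A : Set} (f : A → Bool) (xs : List A) →
                    ∣ tabulate (λ i → f (List.lookup xs i)) ∣ ≡ ∑[ x ∈ xs ] 𝟙 (f x)
∣tabulate∘lookup∣ f []       = refl
∣tabulate∘lookup∣ f (x ∷ xs) with f x
... | true  = cong suc (∣tabulate∘lookup∣ f xs)
... | false = ∣tabulate∘lookup∣ f xs

-- The coefficient of the empty monomial counts fillings by an empty alphabet,
-- of which a nonempty shape has none.
skewSchur≢1 : ∀ {cs s} → s ∈ cs → ¬ (skewSchur cs ≗F oneF)
skewSchur≢1 {_ ∷ _} _ one = 0≢1+n (one [])

buildφ-contents : ∀ D pos xs → map proj₁ (buildφ D pos xs) ≡ xs
buildφ-contents D pos       []       = refl
buildφ-contents D (r , col) (x ∷ xs) = cong (x ∷_) (buildφ-contents D _ xs)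

module _ (D : List Strip) (pos : ℤ × ℤ) (xs : List ℤ) {α β : ℤ} (α∈xs : α ∈ xs) where

  private
    φ : List (ℤ × (ℤ × ℤ))
    φ = buildφ D pos xs

  segment-nonempty : T (α ℤ.≤ᵇ β) → ∃[ s ] s ∈ segment φ α β
  segment-nonempty α≤β with ∈-map⁻ proj₁ (subst (α ∈_) (sym (buildφ-contents D pos xs)) α∈xs)
  ... | e , e∈φ , refl = proj₂ e , ∈-map⁺ proj₂
    (∈-filterB⁺ (λ e → (α ℤ.≤ᵇ proj₁ e) ∧ (proj₁ e ℤ.≤ᵇ β)) e∈φ
                (Equivalence.from T-∧ (ℤP.≤⇒≤ᵇ (ℤP.≤-refl {proj₁ e}) , α≤β)))

  sSeg≗1⇔ : sSeg φ α β ≗F oneF ⇔ α ≡ β ℤ.+ 1ℤ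
  sSeg≗1⇔ = mk⇔ to from
    where
    to : sSeg φ α β ≗F oneF → α ≡ β ℤ.+ 1ℤ
    to one with α ℤ.≤ᵇ β in α≤β | α ℤP.≟ β ℤ.+ 1ℤ
    ... | true  | _         = ⊥-elim (skewSchur≢1 (proj₂ (segment-nonempty (subst T (sym α≤β) _))) one)
    ... | false | yes α≡β+1 = α≡β+1
    ... | false | no  _     = ⊥-elim (0≢1+n (one []))
    from : α ≡ β ℤ.+ 1ℤ → sSeg φ α β ≗F oneF
    from α≡β+1 w with α ℤ.≤ᵇ β in α≤β | α ℤP.≟ β ℤ.+ 1ℤ
    ... | true  | _       =
      ⊥-elim (ℤP.<⇒≱ (i<i+1 β) (subst (ℤ._≤ β) α≡β+1 (ℤP.≤ᵇ⇒≤ (subst T (sym α≤β) _))))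
    ... | false | yes _   = refl
    ... | false | no  α≢  = ⊥-elim (α≢ α≡β+1)

-- Outside decompositions and grank

module OutsideStrips (λ' μ : List ℕ) (λ-partition : IsPartition λ') (μ-partition : IsPartition μ)
                     (D : List Strip) (D-outside : OutsideDecomposition λ' μ D) where

  open SkewShape λ' μ λ-partition μ-partition
  open OutsideDecomposition D-outside

  ∈strip⇒In : ∀ {θ i j} → θ ∈ D → (i , j) ∈ toList θ → In i j
  ∈strip⇒In θ∈ x∈ =
    Equivalence.to inSkew⇔In (Equivalence.to (covers _) (∈-concat⁺′ x∈ (∈-map⁺ toList θ∈)))

  ∑-strips : ∀ (f : Square → ℕ) → ∑[ θ ∈ D ] ∑ (toList θ) f ≡ ∑ cells f
  ∑-strips f = ≡-trans (sym (∑-concatMap toList D f)) (∑-↭ f squares↭cells)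
    where
    squares↭cells : concatMap toList D ↭ cells
    squares↭cells = Unique-↭ disjoint Unique-cells (λ {x} → mk⇔
      (λ x∈ → Equivalence.from ∈cells⇔In (Equivalence.to inSkew⇔In (Equivalence.to (covers x) x∈)))
      (λ x∈ → Equivalence.from (covers x) (Equivalence.from inSkew⇔In (Equivalence.to ∈cells⇔In x∈))))

  starting endingBefore : ℤ → ℕ
  starting c     = ∑[ θ ∈ D ] 𝟙 (eqℤ (τ (p θ)) c)
  endingBefore c = ∑[ θ ∈ D ] 𝟙 (eqℤ (τ (q θ)) (c - 1ℤ))

  diagonalSize≡∑-strips : ∀ c → diagonalSize c ≡ ∑[ θ ∈ D ] countContent c (toList θ)
  diagonalSize≡∑-strips c = ≡-trans (length-filterB _ cells) (sym (∑-strips _))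

  strips-balance : ∀ c → starting c + diagonalSize (c - 1ℤ) ≡ diagonalSize c + endingBefore c
  strips-balance c = begin
    starting c + diagonalSize (c - 1ℤ)
      ≡⟨ cong (starting c +_) (diagonalSize≡∑-strips (c - 1ℤ)) ⟩
    starting c + ∑ D (λ θ → countContent (c - 1ℤ) (toList θ))
      ≡⟨ ∑-+ D _ _ ⟨
    ∑ D (λ θ → 𝟙 (eqℤ (τ (p θ)) c) + countContent (c - 1ℤ) (toList θ))
      ≡⟨ ∑-cong D (λ {θ} θ∈ → strip-balance c (p θ) (List⁺.tail θ) (All.lookup strips θ∈)) ⟩
    ∑ D (λ θ → countContent c (toList θ) + 𝟙 (eqℤ (τ (q θ)) (c - 1ℤ)))
      ≡⟨ ∑-+ D _ _ ⟩
    ∑ D (λ θ → countContent c (toList θ)) + endingBefore c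
      ≡⟨ cong (_+ endingBefore c) (diagonalSize≡∑-strips c) ⟨
    diagonalSize c + endingBefore c
      ∎
    where open ≡-Reasoning

  private
    isStart : Square → Bool
    isStart (i , j) = not (inSkew λ' μ i (j ∸ 1)) ∨ not (inSkew λ' μ (suc i) j)

    startSquare : ∀ {i j} → In i j → T (isStart (i , j)) → StartSquare (i , j)
    startSquare ij start = ij , Sum.map ¬inSkew⇒¬In ¬inSkew⇒¬In (T-not-∨ start)

    endSquare : ∀ {θ} → θ ∈ D → EndSquare (q θ)
    endSquare θ∈ = ∈strip⇒In θ∈ (last-∈ _ _) , Sum.map ¬inSkew⇒¬In ¬inSkew⇒¬In (T-not-∨ (All.lookup ends θ∈))

  starting≤1 : ∀ {c θ'} → θ' ∈ D → τ (q θ') ℤ.+ 1ℤ ≡ c → starting c ≤ 1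
  starting≤1 {c} {θ'} θ'∈ adjacent = begin
    starting c                                ≤⟨ ∑-mono-≤ start-of-strip ⟩
    ∑ D (λ θ → ∑ (toList θ) startOn)          ≡⟨ ∑-strips startOn ⟩
    ∑ cells startOn                           ≡⟨ length-filterB _ cells ⟨
    length (filterB (λ x → isStartOn x) cells) ≤⟨ length≤1 (Unique-filterB _ Unique-cells) all-equal ⟩
    1                                         ∎
    where
    open ≤-Reasoning
    isStartOn : Square → Bool
    isStartOn x = eqℤ (τ x) c ∧ isStart x
    startOn : Square → ℕ
    startOn x = 𝟙 (isStartOn x)
    start-of-strip : ∀ {θ} → θ ∈ D → 𝟙 (eqℤ (τ (p θ)) c) ≤ ∑ (toList θ) startOn
    start-of-strip {θ} θ∈ =
      ≤-trans (𝟙-mono {b = isStartOn (p θ)} (λ same → Equivalence.from T-∧ (same , All.lookup starts θ∈)))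
              (≤-∑ {xs = toList θ} startOn {p θ} (here refl))
    start-of-content : ∀ {x} → x ∈ filterB (λ x → isStartOn x) cells → StartSquare x × τ x ≡ c
    start-of-content {i , j} x∈ with ∈-filterB⁻ _ cells x∈
    ... | x∈cells , t with Equivalence.to T-∧ t
    ... | same , start = startSquare (Equivalence.to ∈cells⇔In x∈cells) start
                       , Equivalence.to (T-does (τ (i , j) ℤP.≟ c)) same
    all-equal : ∀ {x y} → x ∈ filterB (λ x → isStartOn x) cells → y ∈ filterB _ cells → x ≡ y
    all-equal x∈ y∈ with start-of-content x∈ | start-of-content y∈
    ... | x-start , x-content | y-start , y-content = start-unique x-start y-start
      (≡-trans x-content (sym y-content)) (endSquare θ'∈) (≡-trans adjacent (sym x-content))

  endsBefore noEndBefore : ℤ → Bool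
  endsBefore c   = any (λ θ → eqℤ (τ (q θ)) (c - 1ℤ)) D
  noEndBefore c = not (endsBefore c)

  fresh-starts : ∀ c → starting c * 𝟙 (noEndBefore c) ≡ diagonalSize c ∸ diagonalSize (c - 1ℤ)
  fresh-starts c with T? (endsBefore c)
  ... | no none rewrite 𝟙-true (Equivalence.from T-not⇔¬T none) = begin
    starting c * 1                                    ≡⟨ *-identityʳ _ ⟩
    starting c                                        ≡⟨ m+n∸n≡m (starting c) (diagonalSize (c - 1ℤ)) ⟨
    starting c + diagonalSize (c - 1ℤ) ∸ diagonalSize (c - 1ℤ)
                                                      ≡⟨ cong (_∸ diagonalSize (c - 1ℤ)) (strips-balance c) ⟩
    diagonalSize c + endingBefore c ∸ diagonalSize (c - 1ℤ)
                                                      ≡⟨ cong (λ e → diagonalSize c + e ∸ diagonalSize (c - 1ℤ)) no-ending ⟩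
    diagonalSize c + 0 ∸ diagonalSize (c - 1ℤ)        ≡⟨ cong (_∸ diagonalSize (c - 1ℤ)) (+-identityʳ _) ⟩
    diagonalSize c ∸ diagonalSize (c - 1ℤ)            ∎
    where
    open ≡-Reasoning
    no-ending : endingBefore c ≡ 0
    no-ending = ∑-≡0 {xs = D} (λ θ∈ → 𝟙-false (λ ends → none (any⁺ (λ θ → eqℤ (τ (q θ)) (c - 1ℤ)) (lose θ∈ ends))))
  ... | yes some with find (any⁻ _ D some)
  ... | θ' , θ'∈ , ends rewrite 𝟙-false (λ fresh → Equivalence.to (T-not⇔¬T {endsBefore c}) fresh some) =
    ≡-trans (*-zeroʳ (starting c)) (sym (m≤n⇒m∸n≡0 diagonal≤previous))
    where
    adjacent : τ (q θ') ℤ.+ 1ℤ ≡ c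
    adjacent = Equivalence.from +1≡⇔≡-1 (Equivalence.to (T-does (τ (q θ') ℤP.≟ c - 1ℤ)) ends)
    1≤ending : 1 ≤ endingBefore c
    1≤ending = ≤-trans (≤-reflexive (sym (𝟙-true ends))) (≤-∑ (λ θ → 𝟙 (eqℤ (τ (q θ)) (c - 1ℤ))) θ'∈)
    diagonal≤previous : diagonalSize c ≤ diagonalSize (c - 1ℤ)
    diagonal≤previous = +-cancelʳ-≤ (endingBefore c) _ _ (begin
      diagonalSize c + endingBefore c          ≡⟨ strips-balance c ⟨
      starting c + diagonalSize (c - 1ℤ)       ≤⟨ +-monoˡ-≤ _ (≤-trans (starting≤1 θ'∈ adjacent) 1≤ending) ⟩
      endingBefore c + diagonalSize (c - 1ℤ)   ≡⟨ +-comm (endingBefore c) _ ⟩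
      diagonalSize (c - 1ℤ) + endingBefore c   ∎)
      where open ≤-Reasoning

  ∑-fresh-starts≡excess : ∑[ θ ∈ D ] 𝟙 (noEndBefore (τ (p θ))) ≡ excess
  ∑-fresh-starts≡excess = begin
    ∑ D (λ θ → 𝟙 (noEndBefore (τ (p θ))))
      ≡⟨ ∑-fibres ℤP._≟_ D (λ θ → τ (p θ)) _ Unique-contents⁺ start∈contents⁺ ⟩
    ∑ contents⁺ (λ c → ∑ D (λ θ → 𝟙 (eqℤ (τ (p θ)) c) * 𝟙 (noEndBefore (τ (p θ)))))
      ≡⟨ ∑-cong contents⁺ (λ {c} _ → ∑-cong D (λ {θ} _ → 𝟙-does-* ℤP._≟_ (τ (p θ)) c (𝟙 ∘ noEndBefore))) ⟩
    ∑ contents⁺ (λ c → ∑ D (λ θ → 𝟙 (eqℤ (τ (p θ)) c) * 𝟙 (noEndBefore c)))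
      ≡⟨ ∑-cong contents⁺ (λ {c} _ → ∑-*ʳ D _ _) ⟩
    ∑ contents⁺ (λ c → starting c * 𝟙 (noEndBefore c))
      ≡⟨ ∑-cong contents⁺ (λ {c} _ → fresh-starts c) ⟩
    excess
      ∎
    where
    open ≡-Reasoning
    start∈contents⁺ : ∀ {θ} → θ ∈ D → τ (p θ) ∈ contents⁺
    start∈contents⁺ θ∈ = τ∈contents⁺ (Equivalence.from ∈cells⇔In (∈strip⇒In θ∈ (here refl)))

  freshRow : Fin (length D) → Bool
  freshRow i = noEndBefore (τ (p (θ D i)))

  rowHasNoOne⇔ : ∀ i → RowHasNoOne λ' μ D i ⇔ T (freshRow i)
  rowHasNoOne⇔ i = mk⇔ to from
    where
    α = τ (p (θ D i))
    endsAt : Strip → Bool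
    endsAt θ' = eqℤ (τ (q θ')) (α - 1ℤ)
    one⇔ : ∀ j → G λ' μ D i j ≗F oneF ⇔ α ≡ τ (q (θ D j)) ℤ.+ 1ℤ
    one⇔ j = sSeg≗1⇔ D (0ℤ , 0ℤ) (contents λ' μ) (τ∈contents (∈strip⇒In (∈-lookup i) (here refl)))
    ends⇒one : ∀ j → T (endsAt (θ D j)) → G λ' μ D i j ≗F oneF
    ends⇒one j ends = Equivalence.from (one⇔ j)
      (sym (Equivalence.from +1≡⇔≡-1 (Equivalence.to (T-does (τ (q (θ D j)) ℤP.≟ α - 1ℤ)) ends)))
    one⇒ends : ∀ j → G λ' μ D i j ≗F oneF → T (endsAt (θ D j))
    one⇒ends j one = Equivalence.from (T-does (τ (q (θ D j)) ℤP.≟ α - 1ℤ))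
      (Equivalence.to +1≡⇔≡-1 (sym (Equivalence.to (one⇔ j) one)))
    to : RowHasNoOne λ' μ D i → T (freshRow i)
    to no-one = Equivalence.from T-not⇔¬T (λ some → let θ' , θ'∈ , ends = find (any⁻ endsAt D some) in
      no-one (Any.index θ'∈) (ends⇒one (Any.index θ'∈) (subst (T ∘ endsAt) (lookup-index θ'∈) ends)))
    from : T (freshRow i) → RowHasNoOne λ' μ D i
    from fresh j one =
      Equivalence.to T-not⇔¬T fresh (any⁺ endsAt (lose (∈-lookup {xs = D} j) (one⇒ends j one)))

  noOneRows : Subset (length D)
  noOneRows = tabulate freshRow

  ∈noOneRows⇔ : ∀ i → i ∈ₛ noOneRows ⇔ RowHasNoOne λ' μ D i
  ∈noOneRows⇔ i = mk⇔
    (λ (i∈ : i ∈ₛ noOneRows) → Equivalence.from (rowHasNoOne⇔ i)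
      (Equivalence.from T-≡ (≡-trans (sym (lookup∘tabulate freshRow i)) ([]=⇒lookup i∈))))
    (λ no-one → lookup⇒[]= i noOneRows
      (≡-trans (lookup∘tabulate freshRow i) (Equivalence.to T-≡ (Equivalence.to (rowHasNoOne⇔ i) no-one))))

  ∣noOneRows∣≡excess : ∣ noOneRows ∣ ≡ excess
  ∣noOneRows∣≡excess = ≡-trans (∣tabulate∘lookup∣ (λ θ → noEndBefore (τ (p θ))) D) ∑-fresh-starts≡excess

open import Data.Integer using (+_)

theorem3p4 : (λ' μ : List ℕ) → IsPartition λ' → IsPartition μ → μ ⊆ₚ λ' →
    (D : List Strip) → OutsideDecomposition λ' μ D →
    Σ ℕ (λ n → IsGRank λ' μ D n × (+ n ≡ rank λ' μ))
theorem3p4 λ' μ λ-partition μ-partition _ D D-outside =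
  excess , (noOneRows , ∈noOneRows⇔ , ∣noOneRows∣≡excess) , sym rank≡excess
  where
  open SkewShape λ' μ λ-partition μ-partition using (excess)
  open Rank λ' μ λ-partition μ-partition using (rank≡excess)
  open OutsideStrips λ' μ λ-partition μ-partition D D-outside
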